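{- Let $(G,+,\le)$ be a $\mathbb Z$-group. The following are equivalent: (1) $(G,+,\le)$ is Leibnizian; (2) the unordered $\mathbb Z$-group $(G,+,1)$ is Leibnizian; (3) the residue map $\operatorname{res}\colon G\to\hat{\mathbb Z}$ is injective.
   Context: A $\mathbb Z$-group is a model of the first-order theory of $(\mathbb Z,+,\le)$; equivalently, a discretely ordered abelian group $G$ (its least positive element is denoted $1$, and $\mathbb Z$ is identified with the subgroup generated by $1$) such that $G/\mathbb Z$ is divisible. An unordered $\mathbb Z$-group is a model of the theory of $(\mathbb Z,+,1)$; equivalently, a torsion-free abelian group with a distinguished element $1\neq 0$ such that, writing $\mathbb Z$ for the subgroup generated by $1$, $G/\mathbb Z$ is divisible and torsion-free. $\hat{\mathbb Z}=\varprojlim_n\mathbb Z/n\mathbb Z=\prod_p\mathbb Z_p$ is the profinite completion of $\mathbb Z$. For an (unordered) $\mathbb Z$-group $G$, the residue map $\operatorname{res}\colon G\to\hat{\mathbb Z}$ is the unique group homomorphism with $\operatorname{res}(1)=1$ (it combines the unique homomorphisms $G\to\mathbb Z/n\mathbb Z$ sending $1$ to $1$). A structure $M$ is Leibnizian if for any $a\neq b$ in $M$ there is a first-order formula $\varphi(x)$ without parameters with $M\models\varphi(a)$ and $M\not\models\varphi(b)$. -}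

module Defs where

open import Level using (0ℓ)
open import Data.Bool using (Bool; true; false)
open import Data.Nat as ℕ using (ℕ; zero; suc; _%_)
open import Data.Nat.Divisibility using (_∣_)
open import Data.Integer as ℤ using (ℤ; +_; -[1+_])
open import Data.Fin using (Fin)
open import Data.Product using (Σ; ∃; _×_; _,_)
open import Data.Sum using (_⊎_)
open import Data.Empty using (⊥)
open import Data.Unit using (⊤)
open import Relation.Nullary using (¬_)
open import Relation.Binary.PropositionalEquality using (_≡_; _≢_)
open import Algebra.Structures using (IsAbelianGroup)
open import Relation.Binary.Structures using (IsTotalOrder)

module Mult {C : Set} (_+_ : C → C → C) (0# : C) (-_ : C → C) where
  _·_ : ℕ → C → C
  zero  · g = 0#
  suc n · g = g + (n · g)

  ιℤ : C → ℤ → C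
  ιℤ one (+ n)    = n · one
  ιℤ one -[1+ n ] = - (suc n · one)

record ZGroup : Set₁ where
  infixl 6 _+_
  infix 4 _≤_ _<_
  field
    Carrier : Set
    _+_     : Carrier → Carrier → Carrier
    0#      : Carrier
    -_      : Carrier → Carrier
    1#      : Carrier
    _≤_     : Carrier → Carrier → Set
    isAbelianGroup : IsAbelianGroup _≡_ _+_ 0# -_
    isTotalOrder   : IsTotalOrder _≡_ _≤_
    +-mono-≤       : ∀ a b c → a ≤ b → a + c ≤ b + c

  _<_ : Carrier → Carrier → Set
  a < b = (a ≤ b) × (a ≢ b)
  _·_ : ℕ → Carrier → Carrier
  _·_ = Mult._·_ _+_ 0# -_
  ι : ℤ → Carrier
  ι = Mult.ιℤ _+_ 0# -_ 1#
  field
    0<1       : 0# < 1#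
    1-least   : ∀ g → 0# < g → 1# ≤ g
    -- G/Z is divisible
    divisible : ∀ (n : ℕ) → n ≢ 0 → ∀ g → ∃ λ h → ∃ λ (k : ℤ) → g ≡ n · h + ι k

-- Formula true  n : formulas of the ordered language  {+, ≤} (with 0,1,- definable)
-- Formula false n : formulas of the unordered language {+, 1} (with 0,- definable)
-- n = number of free variables (de Bruijn).

data Term (n : ℕ) : Set where
  var  : Fin n → Term n
  zer  : Term n
  one  : Term n
  _⊕_  : Term n → Term n → Term n
  neg  : Term n → Term n

data Formula : Bool → ℕ → Set where
  _≐_  : ∀ {o n} → Term n → Term n → Formula o n
  _≼_  : ∀ {n} → Term n → Term n → Formula true n
  ⊥ᶠ   : ∀ {o n} → Formula o n
  ⊤ᶠ   : ∀ {o n} → Formula o n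
  ¬ᶠ_  : ∀ {o n} → Formula o n → Formula o n
  _∧ᶠ_ : ∀ {o n} → Formula o n → Formula o n → Formula o n
  _∨ᶠ_ : ∀ {o n} → Formula o n → Formula o n → Formula o n
  _⇒ᶠ_ : ∀ {o n} → Formula o n → Formula o n → Formula o n
  ∀ᶠ   : ∀ {o n} → Formula o (suc n) → Formula o n
  ∃ᶠ   : ∀ {o n} → Formula o (suc n) → Formula o n

module Semantics (G : ZGroup) where
  open ZGroup G

  Env : ℕ → Set
  Env n = Fin n → Carrier

  extend : ∀ {n} → Carrier → Env n → Env (suc n)
  extend g ρ Fin.zero    = g
  extend g ρ (Fin.suc i) = ρ i

  ⟦_⟧ : ∀ {n} → Term n → Env n → Carrier
  ⟦ var i ⟧ ρ = ρ i
  ⟦ zer ⟧   ρ = 0#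
  ⟦ one ⟧   ρ = 1#
  ⟦ s ⊕ t ⟧ ρ = ⟦ s ⟧ ρ + ⟦ t ⟧ ρ
  ⟦ neg t ⟧ ρ = - ⟦ t ⟧ ρ

  -- Satisfaction.  For formulas of the unordered language (flag false) the
  -- order is never consulted, so this is satisfaction in the reduct (G,+,1).
  Sat : ∀ {o n} → Formula o n → Env n → Set
  Sat (s ≐ t)   ρ = ⟦ s ⟧ ρ ≡ ⟦ t ⟧ ρ
  Sat (s ≼ t)   ρ = ⟦ s ⟧ ρ ≤ ⟦ t ⟧ ρ
  Sat ⊥ᶠ        ρ = ⊥
  Sat ⊤ᶠ        ρ = ⊤
  Sat (¬ᶠ φ)    ρ = ¬ Sat φ ρ
  Sat (φ ∧ᶠ ψ)  ρ = Sat φ ρ × Sat ψ ρ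
  Sat (φ ∨ᶠ ψ)  ρ = Sat φ ρ ⊎ Sat ψ ρ
  Sat (φ ⇒ᶠ ψ)  ρ = Sat φ ρ → Sat ψ ρ
  Sat (∀ᶠ φ)    ρ = ∀ g → Sat φ (extend g ρ)
  Sat (∃ᶠ φ)    ρ = ∃ λ g → Sat φ (extend g ρ)

  [_] : Carrier → Env 1
  [ a ] _ = a

Leibnizian : Bool → ZGroup → Set
Leibnizian o G = ∀ a b → a ≢ b →
  Σ (Formula o 1) λ φ → Sat φ [ a ] × ¬ Sat φ [ b ]
  where open Semantics G; open ZGroup G

-- Profinite completion Ẑ = lim Z/nZ, as compatible families of residues:
-- digit n ∈ {0,…,n} is the residue modulo (suc n).

record Ẑ : Set where
  field
    digit  : ℕ → ℕ
    digit< : ∀ n → digit n ℕ.< suc n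
    compat : ∀ m k → suc m ∣ suc k → digit k % suc m ≡ digit m
open Ẑ public

_≈Ẑ_ : Ẑ → Ẑ → Set
x ≈Ẑ y = ∀ n → digit x n ≡ digit y n

-- r : G → Ẑ is a group homomorphism with r(1) = 1 (componentwise in Z/nZ).
-- Such a map is unique; it is the residue map res.
IsResidueMap : (G : ZGroup) → (ZGroup.Carrier G → Ẑ) → Set
IsResidueMap G r =
    (∀ a b n → digit (r (a + b)) n ≡ (digit (r a) n ℕ.+ digit (r b) n) % suc n)
  × (∀ n → digit (r 1#) n ≡ 1 % suc n)
  where open ZGroup G

ResInjective : ZGroup → Set
ResInjective G = ∀ (res : ZGroup.Carrier G → Ẑ) → IsResidueMap G res →
  ∀ a b → res a ≈Ẑ res b → a ≡ b

-- (2) ⇒ (1): an unordered formula is also an ordered one.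
-- (3) ⇒ (2): by divisibility of G/Z every g has a unique remainder r < N with
--   g = N · h + r · 1; the remainders form a residue map res, and elements with
--   different remainders modulo N are separated by the formula ∃ y. x = N · y + r.
-- (1) ⇒ (3): every residue map has the digits of res, so if two distinct elements
--   have equal residues their difference gives some c > 0 divisible by every N.
--   Then c and c + c satisfy the same ordered formulas, by an Ehrenfeucht–Fraïssé
--   argument: environments that are congruent modulo M k and give the same signs to
--   all terms of depth ≤ D k ("similar for k rounds") satisfy the same formulas of
--   rank ≤ k.  In one round, a new element a gets a partner b ≡ a (mod M k) such that
--   ℓ · b lies in the same cut of small term values as ℓ · a, where ℓ is a common
--   multiple of all coefficients; this makes all signs agree again.  The environments
--   c and c + c are similar because every one-variable term has a constant sign
--   beyond all integers, where c and c + c both lie.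
--
-- Excluded middle is used because neither equality nor the order of
-- G is decidable.
module Submission where

open import Level using (0ℓ)
open import Axiom.ExcludedMiddle using (ExcludedMiddle)
open import Axiom.DoubleNegationElimination using (em⇒dne)
open import Algebra.Bundles using (AbelianGroup)
open import Data.Bool using (true; false)
open import Data.Empty using (⊥; ⊥-elim)
import Data.Fin as Fin
open import Data.Integer as ℤ using (-[1+_])
open import Data.List using (List; []; _∷_; _++_; map; allFin; cartesianProductWith)
open import Data.List.Membership.Propositional using (_∈_)
open import Data.List.Membership.Propositional.Properties
  using (∈-++⁺ˡ; ∈-++⁺ʳ; ∈-map⁺; ∈-allFin; ∈-cartesianProductWith⁺)
open import Data.List.Relation.Unary.Any using (here; there)
open import Data.Nat as ℕ using (ℕ; zero; suc; _%_; _/_; _⊔_; _^_; _!)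
import Data.Nat.Properties as ℕ
open import Algebra.Properties.CommutativeSemigroup ℕ.+-commutativeSemigroup using ()
  renaming (interchange to ℕ+-interchange)
open import Data.Nat.DivMod
  using (m≡m%n+[m/n]*n; m%n<n; m<n⇒m%n≡m; m%n%n≡m%n; m≤n⇒[n∸m]%m≡n%m; %-distribˡ-+; %-distribˡ-*; m*n%n≡0)
open import Data.Nat.Divisibility
  using (divides; _∣_; quotient; quotient-∣; ∣⇒≤; ∣-trans; m∣m*n; m≤n⇒m!∣n!)
open import Data.Product using (∃; _×_; _,_; proj₁; proj₂)
open import Data.Product.Function.NonDependent.Propositional using (_×-⇔_)
open import Data.Sum using (_⊎_; inj₁; inj₂)
open import Data.Sum.Function.Propositional using (_⊎-⇔_)
open import Function using (_∘_; case_of_)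
open import Function.Bundles using (_⇔_; mk⇔; Equivalence)
import Function.Properties.Equivalence as ⇔
open import Relation.Binary.Bundles using (TotalOrder)
open import Relation.Binary.PropositionalEquality hiding ([_])
open import Relation.Nullary using (¬_; yes; no; contradiction)

open import Defs

module GroupArithmetic (G : ZGroup) where
  open ZGroup G public hiding (_·_; _<_)

  abelianGroup : AbelianGroup 0ℓ 0ℓ
  abelianGroup = record { isAbelianGroup = isAbelianGroup }

  open AbelianGroup abelianGroup public
    using (_-_; assoc; comm; identityˡ; identityʳ; inverseˡ; inverseʳ; commutativeSemigroup; commutativeMonoid)
  open import Algebra.Properties.AbelianGroup abelianGroup public
    using (ε⁻¹≈ε; ⁻¹-∙-comm; x∙y⁻¹≈ε⇒x≈y; xyx⁻¹≈y; \\-leftDividesʳ; //-rightDividesˡ; //-rightDividesʳ)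
  open import Algebra.Properties.AbelianGroup abelianGroup using (quasigroup)
  open import Algebra.Properties.Quasigroup quasigroup public using (cancelˡ; cancelʳ)
  open import Algebra.Properties.CommutativeSemigroup commutativeSemigroup public using (interchange; xy∙z≈xz∙y)
  open import Algebra.Properties.CommutativeMonoid.Mult commutativeMonoid public
    using (×-homo-+; ×-assocˡ; ×-distrib-+) renaming (_×_ to _·_)
  open ≡-Reasoning

  ·-def : ∀ n x → ZGroup._·_ G n x ≡ n · x
  ·-def zero    x = refl
  ·-def (suc n) x = cong (x +_) (·-def n x)

  [x+z]-[y+z]≡x-y : ∀ x y z → (x + z) - (y + z) ≡ x - y
  [x+z]-[y+z]≡x-y x y z = begin
    (x + z) - (y + z)      ≡⟨ cong ((x + z) +_) (sym (⁻¹-∙-comm y z)) ⟩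
    (x + z) + (- y + - z)  ≡⟨ interchange x z (- y) (- z) ⟩
    (x - y) + (z - z)      ≡⟨ cong ((x - y) +_) (inverseʳ z) ⟩
    (x - y) + 0#           ≡⟨ identityʳ (x - y) ⟩
    x - y                  ∎

  swap-sides : ∀ a b c d → a + b ≡ c + d → - a + c ≡ b - d
  swap-sides a b c d e = begin
    - a + c                ≡⟨ sym (//-rightDividesʳ d (- a + c)) ⟩
    (- a + c) + d - d      ≡⟨ cong (_- d) (assoc (- a) c d) ⟩
    - a + (c + d) - d      ≡⟨ cong (λ z → - a + z - d) (sym e) ⟩
    - a + (a + b) - d      ≡⟨ cong (_- d) (sym (assoc (- a) a b)) ⟩
    (- a + a) + b - d      ≡⟨ cong (λ z → z + b - d) (inverseˡ a) ⟩
    0# + b - d             ≡⟨ cong (_- d) (identityˡ b) ⟩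
    b - d                  ∎

  sub-rearrange : ∀ x y p q → x - y ≡ p + q → y + p ≡ x - q
  sub-rearrange x y p q e = begin
    y + p                  ≡⟨ sym (//-rightDividesʳ q (y + p)) ⟩
    y + p + q - q          ≡⟨ cong (_- q) (assoc y p q) ⟩
    y + (p + q) - q        ≡⟨ cong (λ z → y + z - q) (sym e) ⟩
    y + (x - y) - q        ≡⟨ cong (_- q) (trans (comm y (x - y)) (//-rightDividesˡ y x)) ⟩
    x - q                  ∎

  ·-0 : ∀ n → n · 0# ≡ 0#
  ·-0 zero    = refl
  ·-0 (suc n) = trans (identityˡ _) (·-0 n)

  ·-neg : ∀ n x → n · (- x) ≡ - (n · x)
  ·-neg zero    x = sym ε⁻¹≈ε
  ·-neg (suc n) x = trans (cong (- x +_) (·-neg n x)) (⁻¹-∙-comm x (n · x))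

  ·-sub : ∀ n x y → n · (x - y) ≡ n · x - n · y
  ·-sub n x y = trans (×-distrib-+ x (- y) n) (cong (n · x +_) (·-neg n y))

  ·-linear : ∀ e μ x y → e · (μ · x + y) ≡ (e ℕ.* μ) · x + e · y
  ·-linear e μ x y = trans (×-distrib-+ (μ · x) y e) (cong (_+ e · y) (×-assocˡ x e μ))

  solve-equal : ∀ p x V R → V + p · x ≡ p · x + R → V ≡ R
  solve-equal p x V R e = cancelʳ (p · x) V R (trans e (comm (p · x) R))

  solve-greater : ∀ q k x V R → V + q · x ≡ suc (q ℕ.+ k) · x + R → V ≡ suc k · x + R
  solve-greater q k x V R e = cancelʳ (q · x) V (suc k · x + R) (begin
    V + q · x                    ≡⟨ e ⟩
    suc (q ℕ.+ k) · x + R        ≡⟨ cong (λ z → suc z · x + R) (ℕ.+-comm q k) ⟩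
    (suc k ℕ.+ q) · x + R        ≡⟨ cong (_+ R) (×-homo-+ x (suc k) q) ⟩
    suc k · x + q · x + R        ≡⟨ xy∙z≈xz∙y _ _ _ ⟩
    suc k · x + R + q · x        ∎)

  solve-less : ∀ p k x V R → V + suc (p ℕ.+ k) · x ≡ p · x + R → V + suc k · x ≡ R
  solve-less p k x V R e = cancelʳ (p · x) (V + suc k · x) R (begin
    V + suc k · x + p · x        ≡⟨ assoc V _ _ ⟩
    V + (suc k · x + p · x)      ≡⟨ cong (V +_) (sym (×-homo-+ x (suc k) p)) ⟩
    V + (suc k ℕ.+ p) · x        ≡⟨ cong (λ z → V + suc z · x) (ℕ.+-comm k p) ⟩
    V + suc (p ℕ.+ k) · x        ≡⟨ e ⟩
    p · x + R                    ≡⟨ comm (p · x) R ⟩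
    R + p · x                    ∎)

-- Order-theoretic facts about a Z-group.  The order is only known to be a
-- total order, not a decidable one, so a few steps use excluded middle.
module OrderedArithmetic (em : ExcludedMiddle 0ℓ) (G : ZGroup) where
  open GroupArithmetic G public

  totalOrder : TotalOrder 0ℓ 0ℓ 0ℓ
  totalOrder = record { isTotalOrder = isTotalOrder }

  open TotalOrder totalOrder public using (total; antisym)
    renaming (refl to ≤-refl; trans to ≤-trans; reflexive to ≤-reflexive)
  open import Relation.Binary.Properties.TotalOrder totalOrder public
    using (_<_; ≰⇒>; <⇒≱; <-trans; ≥-totalOrder)
  import Relation.Binary.Construct.NonStrictToStrict _≡_ _≤_ as Strict

  ≤-<-trans : ∀ {a b c} → a ≤ b → b < c → a < c
  ≤-<-trans = Strict.≤-<-trans ≤-trans antisym (subst (_≤ _))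

  <-≤-trans : ∀ {a b c} → a < b → b ≤ c → a < c
  <-≤-trans = Strict.<-≤-trans sym ≤-trans antisym (subst (_ ≤_))

  dne : ∀ {P : Set} → ¬ ¬ P → P
  dne = em⇒dne em

  +-monoʳ-≤ : ∀ {a b} c → a ≤ b → a + c ≤ b + c
  +-monoʳ-≤ {a} {b} c = +-mono-≤ a b c

  +-monoˡ-≤ : ∀ {a b} c → a ≤ b → c + a ≤ c + b
  +-monoˡ-≤ {a} {b} c p = subst₂ _≤_ (comm a c) (comm b c) (+-monoʳ-≤ c p)

  +-mono₂-≤ : ∀ {a b c d} → a ≤ b → c ≤ d → a + c ≤ b + d
  +-mono₂-≤ {b = b} {c} p q = ≤-trans (+-monoʳ-≤ c p) (+-monoˡ-≤ b q)

  +-cancelʳ-≤ : ∀ {a b} c → a + c ≤ b + c → a ≤ b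
  +-cancelʳ-≤ {a} {b} c p = subst₂ _≤_ (//-rightDividesʳ c a) (//-rightDividesʳ c b) (+-monoʳ-≤ (- c) p)

  +-monoʳ-< : ∀ {a b} c → a < b → a + c < b + c
  +-monoʳ-< c (p , a≢b) = +-monoʳ-≤ c p , λ e → a≢b (cancelʳ c _ _ e)

  +-monoˡ-< : ∀ {a b} c → a < b → c + a < c + b
  +-monoˡ-< c (p , a≢b) = +-monoˡ-≤ c p , λ e → a≢b (cancelˡ c _ _ e)

  ≤0⇒≤neg : ∀ {x y} → x + y ≤ 0# → x ≤ - y
  ≤0⇒≤neg {x} {y} p = subst₂ _≤_ (//-rightDividesʳ y x) (identityˡ (- y)) (+-monoʳ-≤ (- y) p)

  ≤neg⇒≤0 : ∀ {x y} → x ≤ - y → x + y ≤ 0#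
  ≤neg⇒≤0 {x} {y} p = subst (x + y ≤_) (inverseˡ y) (+-monoʳ-≤ y p)

  ≤⇒sub≤0 : ∀ {a b} → a ≤ b → a - b ≤ 0#
  ≤⇒sub≤0 {a} {b} p = subst (a - b ≤_) (inverseʳ b) (+-monoʳ-≤ (- b) p)

  sub≤0⇒≤ : ∀ {a b} → a - b ≤ 0# → a ≤ b
  sub≤0⇒≤ {a} {b} p = subst₂ _≤_ (//-rightDividesˡ b a) (identityˡ b) (+-monoʳ-≤ b p)

  neg-antitone-≤ : ∀ {a b} → a ≤ b → - b ≤ - a
  neg-antitone-≤ {a} {b} p = ≤0⇒≤neg (subst (_≤ 0#) (comm a (- b)) (≤⇒sub≤0 p))

  <⇒+1≤ : ∀ {a b} → a < b → a + 1# ≤ b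
  <⇒+1≤ {a} {b} p = subst₂ _≤_ (comm 1# a) (//-rightDividesˡ a b) (+-monoʳ-≤ a (1-least (b - a) 0<b-a))
    where
    0<b-a : 0# < b - a
    0<b-a = subst (_< b - a) (inverseʳ a) (+-monoʳ-< (- a) p)

  pos⇒x≢x+x : ∀ {x} → 0# < x → x ≢ x + x
  pos⇒x≢x+x {x} 0<x x≡x+x = proj₂ 0<x (cancelˡ x 0# x (trans (identityʳ x) x≡x+x))

  x<x+1 : ∀ x → x < x + 1#
  x<x+1 x = subst (_< x + 1#) (identityʳ x) (+-monoˡ-< x 0<1)

  ·-mono-≤ : ∀ n {a b} → a ≤ b → n · a ≤ n · b
  ·-mono-≤ zero    p = ≤-refl
  ·-mono-≤ (suc n) p = +-mono₂-≤ p (·-mono-≤ n p)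

  ·-mono-< : ∀ n {a b} → a < b → suc n · a < suc n · b
  ·-mono-< n {a} {b} p = <-≤-trans (+-monoʳ-< (n · a) p) (+-monoˡ-≤ b (·-mono-≤ n (proj₁ p)))

  ·-cancel-≤ : ∀ n {a b} → suc n · a ≤ suc n · b → a ≤ b
  ·-cancel-≤ n p = dne λ a≰b → <⇒≱ (·-mono-< n (≰⇒> a≰b)) p

  ·-nonpos : ∀ n {a} → a ≤ 0# → n · a ≤ 0#
  ·-nonpos n {a} p = subst (n · a ≤_) (·-0 n) (·-mono-≤ n p)

  ·-cancel-nonpos : ∀ n {a} → suc n · a ≤ 0# → a ≤ 0#
  ·-cancel-nonpos n {a} p = ·-cancel-≤ n (subst (suc n · a ≤_) (sym (·-0 (suc n))) p)

  ·-nonneg : ∀ n {a} → 0# ≤ a → 0# ≤ n · a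
  ·-nonneg n {a} p = subst (_≤ n · a) (·-0 n) (·-mono-≤ n p)

  numeral-nonneg : ∀ j → 0# ≤ j · 1#
  numeral-nonneg j = ·-nonneg j (proj₁ 0<1)

  gap : ∀ x y m → x < y → (∀ j → j ℕ.≤ m → y ≢ x + j · 1#) → x + m · 1# < y
  gap x y zero    x<y far = subst (_< y) (sym (identityʳ x)) x<y
  gap x y (suc m) x<y far =
    subst (_≤ y) x+m+1≡ (<⇒+1≤ (gap x y m x<y (λ j j≤m → far j (ℕ.m≤n⇒m≤1+n j≤m)))) ,
    λ e → far (suc m) ℕ.≤-refl (sym e)
    where
    x+m+1≡ : x + m · 1# + 1# ≡ x + suc m · 1#
    x+m+1≡ = trans (assoc x (m · 1#) 1#) (cong (x +_) (comm (m · 1#) 1#))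

  sub-numeral-≤ : ∀ x r → x - r · 1# ≤ x
  sub-numeral-≤ x r = subst (x - r · 1# ≤_) (identityʳ x)
                        (+-monoˡ-≤ x (subst (- (r · 1#) ≤_) ε⁻¹≈ε (neg-antitone-≤ (numeral-nonneg r))))

  numeral-mono-< : ∀ {i j} → i ℕ.< j → i · 1# < j · 1#
  numeral-mono-< {i} {j} i<j = subst₂ _<_ (identityˡ (i · 1#)) j·1≡ (+-monoʳ-< (i · 1#) 0<j-i)
    where
    0<j-i : 0# < (j ℕ.∸ i) · 1#
    0<j-i with j ℕ.∸ i | ℕ.m>n⇒m∸n≢0 i<j
    ... | zero  | j-i≢0 = ⊥-elim (j-i≢0 refl)
    ... | suc l | _     = <-≤-trans 0<1 (subst (_≤ suc l · 1#) (identityʳ 1#) (+-monoˡ-≤ 1# (numeral-nonneg l)))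
    j·1≡ : (j ℕ.∸ i) · 1# + i · 1# ≡ j · 1#
    j·1≡ = trans (sym (×-homo-+ 1# (j ℕ.∸ i) i)) (cong (_· 1#) (ℕ.m∸n+n≡m (ℕ.<⇒≤ i<j)))

[m+n]%N≡n⇒m≡0 : ∀ m n N .{{_ : ℕ.NonZero N}} → m ℕ.< N → n ℕ.< N → (m ℕ.+ n) % N ≡ n → m ≡ 0
[m+n]%N≡n⇒m≡0 m n N m<N n<N e with m ℕ.+ n ℕ.<? N
... | yes m+n<N = ℕ.+-cancelʳ-≡ n m 0 (trans (sym (m<n⇒m%n≡m m+n<N)) e)
... | no  m+n≮N = ⊥-elim (ℕ.<-irrefl m≡N m<N)
  where
  open ℕ.≤-Reasoning
  N≤m+n : N ℕ.≤ m ℕ.+ n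
  N≤m+n = ℕ.≮⇒≥ m+n≮N
  -- m + n ∸ N is already reduced, hence equal to n
  m+n∸N≡n : m ℕ.+ n ℕ.∸ N ≡ n
  m+n∸N≡n = trans (sym (m<n⇒m%n≡m (ℕ.+-cancelʳ-< N _ N (begin-strict
      m ℕ.+ n ℕ.∸ N ℕ.+ N ≡⟨ ℕ.m∸n+n≡m N≤m+n ⟩
      m ℕ.+ n             <⟨ ℕ.+-mono-< m<N n<N ⟩
      N ℕ.+ N             ∎))))
    (trans (m≤n⇒[n∸m]%m≡n%m N≤m+n) e)
  m≡N : m ≡ N
  m≡N = ℕ.+-cancelʳ-≡ n m N (trans (sym (ℕ.m∸n+n≡m N≤m+n))
          (trans (cong (ℕ._+ N) m+n∸N≡n) (ℕ.+-comm n N)))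

-- Every element of a Z-group has a unique remainder modulo each N = suc Q:
-- g = N · h + r · 1 with r < N.  This is where divisibility of G/Z enters.
module DivisionWithRemainder (em : ExcludedMiddle 0ℓ) (G : ZGroup) where
  open OrderedArithmetic em G public
  open ≡-Reasoning

  regroup : ∀ N h y z → N · h + (N · y + z) ≡ N · (h + y) + z
  regroup N h y z = trans (sym (assoc _ _ _)) (cong (_+ z) (sym (×-distrib-+ h y N)))

  numeral-divMod : ∀ Q j → j · 1# ≡ suc Q · ((j / suc Q) · 1#) + (j % suc Q) · 1#
  numeral-divMod Q j = begin
    j · 1#                              ≡⟨ cong (_· 1#) (m≡m%n+[m/n]*n j N) ⟩
    (j % N ℕ.+ (j / N) ℕ.* N) · 1#      ≡⟨ ×-homo-+ 1# (j % N) _ ⟩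
    (j % N) · 1# + ((j / N) ℕ.* N) · 1# ≡⟨ cong (λ z → (j % N) · 1# + z · 1#) (ℕ.*-comm (j / N) N) ⟩
    (j % N) · 1# + (N ℕ.* (j / N)) · 1# ≡⟨ cong ((j % N) · 1# +_) (sym (×-assocˡ 1# N (j / N))) ⟩
    (j % N) · 1# + N · ((j / N) · 1#)   ≡⟨ comm _ _ ⟩
    N · ((j / N) · 1#) + (j % N) · 1#   ∎
    where
    N : ℕ
    N = suc Q

  neg-numeral : ∀ Q s → - (s · 1#) ≡ suc Q · (- (s · 1#)) + (Q ℕ.* s) · 1#
  neg-numeral Q s = sym (begin
    N · (- (s · 1#)) + Qs                    ≡⟨ cong (_+ Qs) (·-neg N (s · 1#)) ⟩
    - (N · (s · 1#)) + Qs                    ≡⟨ cong (λ z → - z + Qs) (×-assocˡ 1# N s) ⟩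
    - ((s ℕ.+ Q ℕ.* s) · 1#) + Qs            ≡⟨ cong (λ z → - z + Qs) (×-homo-+ 1# s (Q ℕ.* s)) ⟩
    - (s · 1# + Qs) + Qs                     ≡⟨ cong (_+ Qs) (sym (⁻¹-∙-comm _ _)) ⟩
    - (s · 1#) + - Qs + Qs                   ≡⟨ //-rightDividesˡ Qs _ ⟩
    - (s · 1#)                               ∎)
    where
    N : ℕ
    N = suc Q
    Qs : Carrier
    Qs = (Q ℕ.* s) · 1#

  integer-divMod : ∀ Q k → ∃ λ y → ∃ λ r → r ℕ.< suc Q × ι k ≡ suc Q · y + r · 1#
  integer-divMod Q (ℤ.+ j) =
    (j / suc Q) · 1# , j % suc Q , m%n<n j (suc Q) , trans (·-def j 1#) (numeral-divMod Q j)
  integer-divMod Q -[1+ j ] = - s·1 + y , r , m%n<n (Q ℕ.* suc j) N , (begin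
      - (ZGroup._·_ G (suc j) 1#)         ≡⟨ cong -_ (·-def (suc j) 1#) ⟩
      - s·1                               ≡⟨ neg-numeral Q (suc j) ⟩
      N · (- s·1) + (Q ℕ.* suc j) · 1#    ≡⟨ cong (N · (- s·1) +_) (numeral-divMod Q (Q ℕ.* suc j)) ⟩
      N · (- s·1) + (N · y + r · 1#)      ≡⟨ regroup N _ y _ ⟩
      N · (- s·1 + y) + r · 1#            ∎)
    where
    N r : ℕ
    N = suc Q
    r = (Q ℕ.* suc j) % N
    s·1 y : Carrier
    s·1 = suc j · 1#
    y = ((Q ℕ.* suc j) / N) · 1#

  -- division with remainder: divide g modulo Z, then divide the integer part
  divMod : ∀ Q g → ∃ λ h → ∃ λ r → r ℕ.< suc Q × g ≡ suc Q · h + r · 1#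
  divMod Q g with divisible (suc Q) (λ ()) g
  ... | h , k , g≡ with integer-divMod Q k
  ...   | y , r , r<N , ιk≡ = h + y , r , r<N ,
          trans g≡ (trans (cong₂ _+_ (·-def (suc Q) h) ιk≡) (regroup (suc Q) h y _))

  small-multiple : ∀ Q D s → s ℕ.< suc Q → suc Q · D ≡ s · 1# → s ≡ 0
  small-multiple Q D zero    _   _ = refl
  small-multiple Q D (suc s) s<N e = ⊥-elim (<⇒≱ (numeral-mono-< s<N) N≤s+1)
    where
    D≰0 : ¬ D ≤ 0#
    D≰0 D≤0 = <⇒≱ (numeral-mono-< {0} {suc s} (ℕ.s≤s ℕ.z≤n))
                  (subst₂ _≤_ e (·-0 (suc Q)) (·-mono-≤ (suc Q) D≤0))
    N≤s+1 : suc Q · 1# ≤ suc s · 1#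
    N≤s+1 = subst (suc Q · 1# ≤_) e (·-mono-≤ (suc Q) (1-least D (≰⇒> D≰0)))

  remainder-unique-≤ : ∀ Q {h h' r r'} → r ℕ.≤ r' → r' ℕ.< suc Q →
                       suc Q · h + r · 1# ≡ suc Q · h' + r' · 1# → r ≡ r'
  remainder-unique-≤ Q {h} {h'} {r} {r'} r≤r' r'<N e =
    sym (trans (sym (ℕ.m∸n+n≡m r≤r')) (cong (ℕ._+ r) s≡0))
    where
    N s : ℕ
    N = suc Q
    s = r' ℕ.∸ r
    Nh≡ : N · h ≡ N · h' + s · 1#
    Nh≡ = cancelʳ (r · 1#) _ _ (begin
      N · h + r · 1#               ≡⟨ e ⟩
      N · h' + r' · 1#             ≡⟨ cong (λ z → N · h' + z · 1#) (sym (ℕ.m∸n+n≡m r≤r')) ⟩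
      N · h' + (s ℕ.+ r) · 1#      ≡⟨ cong (N · h' +_) (×-homo-+ 1# s r) ⟩
      N · h' + (s · 1# + r · 1#)   ≡⟨ sym (assoc _ _ _) ⟩
      N · h' + s · 1# + r · 1#     ∎)
    s≡0 : s ≡ 0
    s≡0 = small-multiple Q (h - h') s (ℕ.≤-<-trans (ℕ.m∸n≤m r' r) r'<N) (begin
      N · (h - h')                 ≡⟨ ·-sub N h h' ⟩
      N · h - N · h'               ≡⟨ cong (_- N · h') Nh≡ ⟩
      N · h' + s · 1# - N · h'     ≡⟨ xyx⁻¹≈y _ _ ⟩
      s · 1#                       ∎)

  remainder-unique : ∀ Q {h h' r r'} → r ℕ.< suc Q → r' ℕ.< suc Q →
                     suc Q · h + r · 1# ≡ suc Q · h' + r' · 1# → r ≡ r'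
  remainder-unique Q {r = r} {r'} r<N r'<N e with ℕ.≤-total r r'
  ... | inj₁ r≤r' = remainder-unique-≤ Q r≤r' r'<N e
  ... | inj₂ r'≤r = sym (remainder-unique-≤ Q r'≤r r<N (sym e))

  remainder-of : ∀ Q {g h h' r} j → r ℕ.< suc Q → g ≡ suc Q · h + r · 1# → g ≡ suc Q · h' + j · 1# →
                 r ≡ j % suc Q
  remainder-of Q {g} {h} {h'} {r} j r<N g≡ g≡' =
    remainder-unique Q r<N (m%n<n j (suc Q)) (begin
      suc Q · h + r · 1#                                           ≡⟨ sym g≡ ⟩
      g                                                            ≡⟨ g≡' ⟩
      suc Q · h' + j · 1#                                          ≡⟨ cong (suc Q · h' +_) (numeral-divMod Q j) ⟩
      suc Q · h' + (suc Q · ((j / suc Q) · 1#) + (j % suc Q) · 1#) ≡⟨ regroup (suc Q) h' _ _ ⟩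
      suc Q · (h' + (j / suc Q) · 1#) + (j % suc Q) · 1#           ∎)

module ResidueMaps (em : ExcludedMiddle 0ℓ) (G : ZGroup) where
  open DivisionWithRemainder em G public
  open ≡-Reasoning

  quot : Carrier → ℕ → Carrier
  quot x n = proj₁ (divMod n x)

  rem : Carrier → ℕ → ℕ
  rem x n = proj₁ (proj₂ (divMod n x))

  rem< : ∀ x n → rem x n ℕ.< suc n
  rem< x n = proj₁ (proj₂ (proj₂ (divMod n x)))

  rem-spec : ∀ x n → x ≡ suc n · quot x n + rem x n · 1#
  rem-spec x n = proj₂ (proj₂ (proj₂ (divMod n x)))

  rem-unique : ∀ {x n h} j → x ≡ suc n · h + j · 1# → rem x n ≡ j % suc n
  rem-unique {x} {n} j = remainder-of n j (rem< x n) (rem-spec x n)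

  res : Carrier → Ẑ
  digit  (res x) = rem x
  digit< (res x) = rem< x
  compat (res x) m k (divides q N≡) = sym (rem-unique (rem x k) (begin
    x                                 ≡⟨ rem-spec x k ⟩
    suc k · quot x k + R              ≡⟨ cong (λ z → z · quot x k + R) (trans N≡ (ℕ.*-comm q (suc m))) ⟩
    (suc m ℕ.* q) · quot x k + R      ≡⟨ cong (_+ R) (sym (×-assocˡ (quot x k) (suc m) q)) ⟩
    suc m · (q · quot x k) + R        ∎))
    where
    R : Carrier
    R = rem x k · 1#

  res-isResidueMap : IsResidueMap G res
  res-isResidueMap = rem-+ , λ n → rem-unique 1 (sym (begin
      suc n · 0# + 1 · 1#  ≡⟨ cong (_+ 1 · 1#) (·-0 (suc n)) ⟩
      0# + 1 · 1#          ≡⟨ identityˡ _ ⟩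
      1# + 0#              ≡⟨ identityʳ 1# ⟩
      1#                   ∎))
    where
    rem-+ : ∀ a b n → rem (a + b) n ≡ (rem a n ℕ.+ rem b n) % suc n
    rem-+ a b n = rem-unique (rem a n ℕ.+ rem b n) (begin
      a + b
        ≡⟨ cong₂ _+_ (rem-spec a n) (rem-spec b n) ⟩
      (N · quot a n + rem a n · 1#) + (N · quot b n + rem b n · 1#)
        ≡⟨ interchange _ _ _ _ ⟩
      (N · quot a n + N · quot b n) + (rem a n · 1# + rem b n · 1#)
        ≡⟨ cong₂ _+_ (sym (×-distrib-+ _ _ N)) (sym (×-homo-+ 1# (rem a n) _)) ⟩
      N · (quot a n + quot b n) + (rem a n ℕ.+ rem b n) · 1#
        ∎)
      where
      N : ℕ
      N = suc n

  same-rem⇒divisible : ∀ a b → (∀ n → rem a n ≡ rem b n) → ∀ n → ∃ λ y → a - b ≡ suc n · y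
  same-rem⇒divisible a b same n = quot a n - quot b n , (begin
    a - b                                            ≡⟨ cong₂ _-_ (rem-spec a n) b≡ ⟩
    (N · quot a n + R) - (N · quot b n + R)          ≡⟨ [x+z]-[y+z]≡x-y _ _ R ⟩
    N · quot a n - N · quot b n                      ≡⟨ sym (·-sub N _ _) ⟩
    N · (quot a n - quot b n)                        ∎)
    where
    N : ℕ
    N = suc n
    R : Carrier
    R = rem a n · 1#
    b≡ : b ≡ N · quot b n + R
    b≡ = trans (rem-spec b n) (cong (λ z → N · quot b n + z · 1#) (sym (same n)))

  module _ {r : Carrier → Ẑ} (isRes : IsResidueMap G r) where
    private
      d : Carrier → ℕ → ℕ
      d x n = digit (r x) n

      d-+ : ∀ a b n → d (a + b) n ≡ (d a n ℕ.+ d b n) % suc n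
      d-+ = proj₁ isRes

    digit-0 : ∀ n → d 0# n ≡ 0
    digit-0 n = [m+n]%N≡n⇒m≡0 (d 0# n) (d 0# n) (suc n) (digit< (r 0#) n) (digit< (r 0#) n)
      (trans (sym (d-+ 0# 0# n)) (cong (λ z → d z n) (identityˡ 0#)))

    digit-· : ∀ m x n → d (m · x) n ≡ (m ℕ.* d x n) % suc n
    digit-· zero    x n = digit-0 n
    digit-· (suc m) x n = begin
      d (x + m · x) n
        ≡⟨ d-+ x (m · x) n ⟩
      (d x n ℕ.+ d (m · x) n) % suc n
        ≡⟨ cong (λ z → (z ℕ.+ d (m · x) n) % suc n) (sym (m<n⇒m%n≡m (digit< (r x) n))) ⟩
      (d x n % suc n ℕ.+ d (m · x) n) % suc n
        ≡⟨ cong (λ z → (d x n % suc n ℕ.+ z) % suc n) (digit-· m x n) ⟩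
      (d x n % suc n ℕ.+ (m ℕ.* d x n) % suc n) % suc n
        ≡⟨ sym (%-distribˡ-+ (d x n) _ (suc n)) ⟩
      (suc m ℕ.* d x n) % suc n
        ∎

    digit-numeral : ∀ j n → d (j · 1#) n ≡ j % suc n
    digit-numeral j n = begin
      d (j · 1#) n                                 ≡⟨ digit-· j 1# n ⟩
      (j ℕ.* d 1# n) % N                           ≡⟨ cong (λ z → (j ℕ.* z) % N) (proj₂ isRes n) ⟩
      (j ℕ.* (1 % N)) % N                          ≡⟨ %-distribˡ-* j _ N ⟩
      ((j % N) ℕ.* (1 % N % N)) % N                ≡⟨ cong (λ z → ((j % N) ℕ.* z) % N) (m%n%n≡m%n 1 N) ⟩
      ((j % N) ℕ.* (1 % N)) % N                    ≡⟨ sym (%-distribˡ-* j 1 N) ⟩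
      (j ℕ.* 1) % N                                ≡⟨ cong (_% N) (ℕ.*-identityʳ j) ⟩
      j % N                                        ∎
      where
      N : ℕ
      N = suc n

    digit-multiple : ∀ n h → d (suc n · h) n ≡ 0
    digit-multiple n h = trans (digit-· (suc n) h n)
      (trans (cong (_% suc n) (ℕ.*-comm (suc n) (d h n))) (m*n%n≡0 (d h n) (suc n)))

    residue-map-unique : ∀ x n → digit (r x) n ≡ rem x n
    residue-map-unique x n = begin
      d x n
        ≡⟨ cong (λ z → d z n) (rem-spec x n) ⟩
      d (suc n · quot x n + rem x n · 1#) n
        ≡⟨ d-+ _ _ n ⟩
      (d (suc n · quot x n) n ℕ.+ d (rem x n · 1#) n) % suc n
        ≡⟨ cong₂ (λ u v → (u ℕ.+ v) % suc n) (digit-multiple n (quot x n)) (digit-numeral (rem x n) n) ⟩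
      (rem x n % suc n) % suc n
        ≡⟨ m%n%n≡m%n (rem x n) (suc n) ⟩
      rem x n % suc n
        ≡⟨ m<n⇒m%n≡m (rem< x n) ⟩
      rem x n
        ∎

numeralᵀ : ∀ {n} → ℕ → Term n
numeralᵀ zero    = zer
numeralᵀ (suc j) = one ⊕ numeralᵀ j

infixr 8 _·ᵀ_
_·ᵀ_ : ∀ {n} → ℕ → Term n → Term n
zero  ·ᵀ t = zer
suc m ·ᵀ t = t ⊕ (m ·ᵀ t)

toOrdered : ∀ {n} → Formula false n → Formula true n
toOrdered (s ≐ t)  = s ≐ t
toOrdered ⊥ᶠ       = ⊥ᶠ
toOrdered ⊤ᶠ       = ⊤ᶠ
toOrdered (¬ᶠ φ)   = ¬ᶠ toOrdered φ
toOrdered (φ ∧ᶠ ψ) = toOrdered φ ∧ᶠ toOrdered ψ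
toOrdered (φ ∨ᶠ ψ) = toOrdered φ ∨ᶠ toOrdered ψ
toOrdered (φ ⇒ᶠ ψ) = toOrdered φ ⇒ᶠ toOrdered ψ
toOrdered (∀ᶠ φ)   = ∀ᶠ (toOrdered φ)
toOrdered (∃ᶠ φ)   = ∃ᶠ (toOrdered φ)

module TermSemantics (G : ZGroup) where
  open GroupArithmetic G
  open Semantics G

  ⟦⟧-ext : ∀ {n} (t : Term n) {ρ ρ' : Env n} → (∀ i → ρ i ≡ ρ' i) → ⟦ t ⟧ ρ ≡ ⟦ t ⟧ ρ'
  ⟦⟧-ext (var i) ρ≗ρ' = ρ≗ρ' i
  ⟦⟧-ext zer     ρ≗ρ' = refl
  ⟦⟧-ext one     ρ≗ρ' = refl
  ⟦⟧-ext (s ⊕ t) ρ≗ρ' = cong₂ _+_ (⟦⟧-ext s ρ≗ρ') (⟦⟧-ext t ρ≗ρ')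
  ⟦⟧-ext (neg t) ρ≗ρ' = cong -_ (⟦⟧-ext t ρ≗ρ')

  numeralᵀ-sem : ∀ {n} j (ρ : Env n) → ⟦ numeralᵀ j ⟧ ρ ≡ j · 1#
  numeralᵀ-sem zero    ρ = refl
  numeralᵀ-sem (suc j) ρ = cong (1# +_) (numeralᵀ-sem j ρ)

  ·ᵀ-sem : ∀ {n} m t (ρ : Env n) → ⟦ m ·ᵀ t ⟧ ρ ≡ m · ⟦ t ⟧ ρ
  ·ᵀ-sem zero    t ρ = refl
  ·ᵀ-sem (suc m) t ρ = cong (⟦ t ⟧ ρ +_) (·ᵀ-sem m t ρ)

  toOrdered-sat : ∀ {n} (φ : Formula false n) ρ → Sat φ ρ ⇔ Sat (toOrdered φ) ρ
  toOrdered-sat (s ≐ t)  ρ = ⇔.refl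
  toOrdered-sat ⊥ᶠ       ρ = ⇔.refl
  toOrdered-sat ⊤ᶠ       ρ = ⇔.refl
  toOrdered-sat (¬ᶠ φ)   ρ = mk⇔ (λ ¬sat → ¬sat ∘ from (toOrdered-sat φ ρ))
                                 (λ ¬sat → ¬sat ∘ to (toOrdered-sat φ ρ))
    where open Equivalence
  toOrdered-sat (φ ∧ᶠ ψ) ρ = toOrdered-sat φ ρ ×-⇔ toOrdered-sat ψ ρ
  toOrdered-sat (φ ∨ᶠ ψ) ρ = toOrdered-sat φ ρ ⊎-⇔ toOrdered-sat ψ ρ
  toOrdered-sat (φ ⇒ᶠ ψ) ρ = mk⇔ (λ f → to (toOrdered-sat ψ ρ) ∘ f ∘ from (toOrdered-sat φ ρ))
                                 (λ f → from (toOrdered-sat ψ ρ) ∘ f ∘ to (toOrdered-sat φ ρ))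
    where open Equivalence
  toOrdered-sat (∀ᶠ φ)   ρ = mk⇔ (λ f g → to (toOrdered-sat φ (extend g ρ)) (f g))
                                 (λ f g → from (toOrdered-sat φ (extend g ρ)) (f g))
    where open Equivalence
  toOrdered-sat (∃ᶠ φ)   ρ = mk⇔ (λ (g , s) → g , to (toOrdered-sat φ (extend g ρ)) s)
                                 (λ (g , s) → g , from (toOrdered-sat φ (extend g ρ)) s)
    where open Equivalence

module Separation (em : ExcludedMiddle 0ℓ) (G : ZGroup) where
  open ResidueMaps em G
  open TermSemantics G
  open Semantics G
  open Equivalence

  unordered⇒ordered : Leibnizian false G → Leibnizian true G
  unordered⇒ordered leib a b a≢b with leib a b a≢b
  ... | φ , sat-a , ¬sat-b = toOrdered φ , to (toOrdered-sat φ [ a ]) sat-a ,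
                             ¬sat-b ∘ from (toOrdered-sat φ [ b ])

  congruentTo : ℕ → ℕ → Formula false 1
  congruentTo n r = ∃ᶠ (var (Fin.suc Fin.zero) ≐ ((suc n ·ᵀ var Fin.zero) ⊕ numeralᵀ r))

  congruentTo-sat : ∀ n r x → Sat (congruentTo n r) [ x ] ⇔ (∃ λ h → x ≡ suc n · h + r · 1#)
  congruentTo-sat n r x = mk⇔ (λ (h , e) → h , trans e (sem h)) (λ (h , e) → h , trans e (sym (sem h)))
    where
    sem : ∀ h → ⟦ (suc n ·ᵀ var Fin.zero) ⊕ numeralᵀ r ⟧ (extend h [ x ]) ≡ suc n · h + r · 1#
    sem h = cong₂ _+_ (·ᵀ-sem (suc n) (var Fin.zero) (extend h [ x ])) (numeralᵀ-sem r (extend h [ x ]))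

  -- Distinct remainders are separated by a congruence formula.
  resInjective⇒unordered : ResInjective G → Leibnizian false G
  resInjective⇒unordered inj a b a≢b with em {∃ λ n → rem a n ≢ rem b n}
  ... | no  same = ⊥-elim (a≢b (inj res res-isResidueMap a b (λ n → dne (λ ne → same (n , ne)))))
  ... | yes (n , differ) = congruentTo n (rem a n) ,
                           from (congruentTo-sat n (rem a n) a) (quot a n , rem-spec a n) ,
                           λ sat-b → differ (sym (b≡ (to (congruentTo-sat n (rem a n) b) sat-b)))
    where
    b≡ : (∃ λ h → b ≡ suc n · h + rem a n · 1#) → rem b n ≡ rem a n
    b≡ (h , e) = trans (rem-unique (rem a n) e) (m<n⇒m%n≡m (rem< a n))

depth : ∀ {n} → Term n → ℕ
depth (var i) = 0
depth zer     = 0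
depth one     = 0
depth (s ⊕ t) = suc (depth s ⊔ depth t)
depth (neg t) = suc (depth t)

atoms : ∀ {n} → List (Term n)
atoms {n} = zer ∷ one ∷ map var (allFin n)

terms : ∀ {n} → ℕ → List (Term n)
terms zero    = atoms
terms (suc k) = atoms ++ cartesianProductWith _⊕_ (terms k) (terms k) ++ map neg (terms k)

terms-complete : ∀ {n} k (t : Term n) → depth t ℕ.≤ k → t ∈ terms k
terms-complete k (var i) _ = atom∈terms k (there (there (∈-map⁺ var (∈-allFin i))))
  where
  atom∈terms : ∀ {n} {t : Term n} k → t ∈ atoms → t ∈ terms k
  atom∈terms zero    t∈ = t∈
  atom∈terms (suc k) t∈ = ∈-++⁺ˡ t∈
terms-complete zero    zer _ = here refl
terms-complete (suc k) zer _ = here refl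
terms-complete zero    one _ = there (here refl)
terms-complete (suc k) one _ = there (here refl)
terms-complete (suc k) (s ⊕ t) (ℕ.s≤s d≤) = ∈-++⁺ʳ atoms (∈-++⁺ˡ (∈-cartesianProductWith⁺ _⊕_
  (terms-complete k s (ℕ.≤-trans (ℕ.m≤m⊔n (depth s) (depth t)) d≤))
  (terms-complete k t (ℕ.≤-trans (ℕ.m≤n⊔m (depth s) (depth t)) d≤))))
terms-complete (suc k) (neg t) (ℕ.s≤s d≤) =
  ∈-++⁺ʳ atoms (∈-++⁺ʳ (cartesianProductWith _⊕_ (terms k) (terms k)) (∈-map⁺ neg (terms-complete k t d≤)))

depth-numeralᵀ : ∀ {n} j → depth (numeralᵀ {n} j) ℕ.≤ j
depth-numeralᵀ zero    = ℕ.z≤n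
depth-numeralᵀ (suc j) = ℕ.s≤s (ℕ.⊔-lub ℕ.z≤n (depth-numeralᵀ j))

depth-·ᵀ : ∀ {n} e (t : Term n) → depth (e ·ᵀ t) ℕ.≤ e ℕ.+ depth t
depth-·ᵀ zero    t = ℕ.z≤n
depth-·ᵀ (suc e) t = ℕ.s≤s (ℕ.⊔-lub (ℕ.m≤n+m (depth t) e) (depth-·ᵀ e t))

-- the comparison u ≤ w is the sign condition u - w ≤ 0
depth-difference : ∀ {n} X (u w : Term n) → depth u ℕ.≤ X → depth w ℕ.≤ X →
                   depth (u ⊕ neg w) ℕ.≤ 2 ℕ.+ X
depth-difference X u w du dw = ℕ.s≤s (ℕ.⊔-lub (ℕ.m≤n⇒m≤1+n du) (ℕ.s≤s dw))

-- Isolating the first variable x of a term t:  t + minus · x = plus · x + rest,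
-- where rest does not mention x.
record Linear (n : ℕ) : Set where
  constructor linear
  field
    plus minus : ℕ
    rest       : Term n
open Linear

isolate : ∀ {n} → Term (suc n) → Linear n
isolate (var Fin.zero)    = linear 1 0 zer
isolate (var (Fin.suc i)) = linear 0 0 (var i)
isolate zer               = linear 0 0 zer
isolate one               = linear 0 0 one
isolate (s ⊕ t)           = linear (plus (isolate s) ℕ.+ plus (isolate t))
                                   (minus (isolate s) ℕ.+ minus (isolate t))
                                   (rest (isolate s) ⊕ rest (isolate t))
isolate (neg t)           = linear (minus (isolate t)) (plus (isolate t)) (neg (rest (isolate t)))

depth-rest : ∀ {n} (t : Term (suc n)) → depth (rest (isolate t)) ℕ.≤ depth t
depth-rest (var Fin.zero)    = ℕ.z≤n
depth-rest (var (Fin.suc i)) = ℕ.z≤n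
depth-rest zer               = ℕ.z≤n
depth-rest one               = ℕ.z≤n
depth-rest (s ⊕ t)           = ℕ.s≤s (ℕ.⊔-mono-≤ (depth-rest s) (depth-rest t))
depth-rest (neg t)           = ℕ.s≤s (depth-rest t)

coefficients-bound : ∀ {n} (t : Term (suc n)) → plus (isolate t) ℕ.+ minus (isolate t) ℕ.≤ 2 ^ depth t
coefficients-bound (var Fin.zero)    = ℕ.≤-refl
coefficients-bound (var (Fin.suc i)) = ℕ.z≤n
coefficients-bound zer               = ℕ.z≤n
coefficients-bound one               = ℕ.z≤n
coefficients-bound (s ⊕ t) = begin
    (p₁ ℕ.+ p₂) ℕ.+ (q₁ ℕ.+ q₂)   ≡⟨ ℕ+-interchange p₁ p₂ q₁ q₂ ⟩
    (p₁ ℕ.+ q₁) ℕ.+ (p₂ ℕ.+ q₂)   ≤⟨ ℕ.+-mono-≤ (bound s (ℕ.m≤m⊔n (depth s) (depth t)))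
                                                (bound t (ℕ.m≤n⊔m (depth s) (depth t))) ⟩
    2 ^ m ℕ.+ 2 ^ m               ≡⟨ cong (2 ^ m ℕ.+_) (sym (ℕ.+-identityʳ _)) ⟩
    2 ^ depth (s ⊕ t)             ∎
  where
  open ℕ.≤-Reasoning
  m p₁ q₁ p₂ q₂ : ℕ
  m = depth s ⊔ depth t
  p₁ = plus (isolate s); q₁ = minus (isolate s); p₂ = plus (isolate t); q₂ = minus (isolate t)
  bound : ∀ u → depth u ℕ.≤ m → plus (isolate u) ℕ.+ minus (isolate u) ℕ.≤ 2 ^ m
  bound u du = ℕ.≤-trans (coefficients-bound u) (ℕ.^-monoʳ-≤ 2 du)
coefficients-bound (neg t) = ℕ.≤-trans (ℕ.≤-reflexive (ℕ.+-comm (minus (isolate t)) (plus (isolate t))))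
                                       (ℕ.≤-trans (coefficients-bound t) (ℕ.m≤m+n _ _))

-- ℓ d = (2^d)! is a common multiple of the coefficients of x in terms of depth ≤ d;
-- the cofactor is returned together with a bound on it.
ℓ : ℕ → ℕ
ℓ d = (2 ^ d) !

cofactor : ∀ d μ → 1 ℕ.≤ μ → μ ℕ.≤ 2 ^ d → ∃ λ e → ℓ d ≡ suc e ℕ.* μ × suc e ℕ.≤ ℓ d
cofactor d (suc μ) _ μ≤ =
  from-quotient (quotient μ∣ℓ) (_∣_.equality μ∣ℓ) (∣⇒≤ {{ℕ._!≢0 (2 ^ d)}} (quotient-∣ μ∣ℓ))
  where
  μ∣ℓ : suc μ ∣ ℓ d
  μ∣ℓ = ∣-trans (m∣m*n (μ !)) (m≤n⇒m!∣n! μ≤)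
  from-quotient : ∀ q → ℓ d ≡ q ℕ.* suc μ → q ℕ.≤ ℓ d →
                  ∃ λ e → ℓ d ≡ suc e ℕ.* suc μ × suc e ℕ.≤ ℓ d
  from-quotient zero    ℓ≡0 _ = contradiction (subst (1 ℕ.≤_) ℓ≡0 (ℕ.1≤n! (2 ^ d))) λ ()
  from-quotient (suc e) ℓ≡  e≤ = e , ℓ≡ , e≤

-- The terms compared with ℓ d · x after scaling a term of depth ≤ d by a
-- cofactor have depth ≤ κ d.
κ : ℕ → ℕ
κ d = suc (ℓ d ℕ.+ d)

depth-scaled : ∀ {n} d e (r : Term n) → e ℕ.≤ ℓ d → depth r ℕ.≤ d →
               depth (e ·ᵀ r) ℕ.≤ ℓ d ℕ.+ d
depth-scaled d e r e≤ dr = ℕ.≤-trans (depth-·ᵀ e r) (ℕ.+-mono-≤ e≤ dr)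

-- A bound on quantifier depth and on the depth of the atoms of a formula.
rank : ∀ {n} → Formula true n → ℕ
rank (s ≐ t)  = 2 ℕ.+ (depth s ℕ.+ depth t)
rank (s ≼ t)  = 2 ℕ.+ (depth s ℕ.+ depth t)
rank ⊥ᶠ       = 0
rank ⊤ᶠ       = 0
rank (¬ᶠ φ)   = rank φ
rank (φ ∧ᶠ ψ) = rank φ ⊔ rank ψ
rank (φ ∨ᶠ ψ) = rank φ ⊔ rank ψ
rank (φ ⇒ᶠ ψ) = rank φ ⊔ rank ψ
rank (∀ᶠ φ)   = suc (rank φ)
rank (∃ᶠ φ)   = suc (rank φ)

module SignTransfer (em : ExcludedMiddle 0ℓ) (G : ZGroup) where
  open OrderedArithmetic em G
  open TermSemantics G
  open Semantics G
  open ≡-Reasoning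

  SignsTransfer : ∀ {n} → ℕ → Env n → Env n → Set
  SignsTransfer d ρ ρ' = ∀ t → depth t ℕ.≤ d → ⟦ t ⟧ ρ ≤ 0# → ⟦ t ⟧ ρ' ≤ 0#

  ≤-transfer : ∀ {n d} {ρ ρ' : Env n} → SignsTransfer d ρ ρ' → ∀ u w → depth (u ⊕ neg w) ℕ.≤ d →
               ⟦ u ⟧ ρ ≤ ⟦ w ⟧ ρ → ⟦ u ⟧ ρ' ≤ ⟦ w ⟧ ρ'
  ≤-transfer tr u w dp p = sub≤0⇒≤ (tr (u ⊕ neg w) dp (≤⇒sub≤0 p))

  SameCut : ∀ {n} → ℕ → ℕ → Carrier → Carrier → Env n → Env n → Set
  SameCut L K a b ρ ρ' = ∀ u → depth u ℕ.≤ K →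
    (⟦ u ⟧ ρ ≤ L · a → ⟦ u ⟧ ρ' ≤ L · b) × (L · a ≤ ⟦ u ⟧ ρ → L · b ≤ ⟦ u ⟧ ρ')

  isolate-sem : ∀ {n} (t : Term (suc n)) x (σ : Env n) →
    ⟦ t ⟧ (extend x σ) + minus (isolate t) · x ≡ plus (isolate t) · x + ⟦ rest (isolate t) ⟧ σ
  isolate-sem (var Fin.zero)    x σ = trans (identityʳ x) (sym (trans (identityʳ _) (identityʳ x)))
  isolate-sem (var (Fin.suc i)) x σ = comm _ _
  isolate-sem zer               x σ = refl
  isolate-sem one               x σ = comm _ _
  isolate-sem (s ⊕ t)           x σ = begin
      (S + T) + (q₁ ℕ.+ q₂) · x          ≡⟨ cong ((S + T) +_) (×-homo-+ x q₁ q₂) ⟩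
      (S + T) + (q₁ · x + q₂ · x)        ≡⟨ interchange _ _ _ _ ⟩
      (S + q₁ · x) + (T + q₂ · x)        ≡⟨ cong₂ _+_ (isolate-sem s x σ) (isolate-sem t x σ) ⟩
      (p₁ · x + S') + (p₂ · x + T')      ≡⟨ interchange _ _ _ _ ⟩
      (p₁ · x + p₂ · x) + (S' + T')      ≡⟨ cong (_+ (S' + T')) (sym (×-homo-+ x p₁ p₂)) ⟩
      (p₁ ℕ.+ p₂) · x + (S' + T')        ∎
    where
    S T S' T' : Carrier
    S = ⟦ s ⟧ (extend x σ); T = ⟦ t ⟧ (extend x σ)
    S' = ⟦ rest (isolate s) ⟧ σ; T' = ⟦ rest (isolate t) ⟧ σ
    p₁ q₁ p₂ q₂ : ℕ
    p₁ = plus (isolate s); q₁ = minus (isolate s); p₂ = plus (isolate t); q₂ = minus (isolate t)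
  isolate-sem (neg t)           x σ = swap-sides _ _ _ _ (isolate-sem t x σ)

  scale : ∀ d {e μ} x y → ℓ d ≡ suc e ℕ.* μ → suc e · (μ · x + y) ≡ ℓ d · x + suc e · y
  scale d {e} {μ} x y ℓ≡ = trans (·-linear (suc e) μ x y) (cong (λ z → z · x + suc e · y) (sym ℓ≡))

  -- Sign transfer for  μ · x + r ≤ 0  with 1 ≤ μ ≤ 2^d: it says ℓ d · x ≤ - (e · r).
  positive-case : ∀ {n d} {ρ ρ' : Env n} {a b} → SameCut (ℓ d) (κ d) a b ρ ρ' →
    ∀ k (r : Term n) → suc k ℕ.≤ 2 ^ d → depth r ℕ.≤ d →
    suc k · a + ⟦ r ⟧ ρ ≤ 0# → suc k · b + ⟦ r ⟧ ρ' ≤ 0#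
  positive-case {n} {d} {ρ} {ρ'} {a} {b} cut k r μ≤ dr sa≤0 with cofactor d (suc k) (ℕ.s≤s ℕ.z≤n) μ≤
  ... | e , ℓ≡ , e≤ =
    ·-cancel-nonpos e (subst (_≤ 0#) (sym (scale d {e} {suc k} b (⟦ r ⟧ ρ') ℓ≡)) (≤neg⇒≤0 Lb≤u))
    where
    u : Term n
    u = neg (suc e ·ᵀ r)
    du : depth u ℕ.≤ κ d
    du = ℕ.s≤s (depth-scaled d (suc e) r e≤ dr)
    La≤u : ℓ d · a ≤ ⟦ u ⟧ ρ
    La≤u = subst (ℓ d · a ≤_) (cong -_ (sym (·ᵀ-sem (suc e) r ρ)))
             (≤0⇒≤neg (subst (_≤ 0#) (scale d {e} {suc k} a (⟦ r ⟧ ρ) ℓ≡) (·-nonpos (suc e) sa≤0)))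
    Lb≤u : ℓ d · b ≤ - (suc e · ⟦ r ⟧ ρ')
    Lb≤u = subst (ℓ d · b ≤_) (cong -_ (·ᵀ-sem (suc e) r ρ')) (proj₂ (cut u du) La≤u)

  -- Sign transfer for  r ≤ ν · x  with 1 ≤ ν ≤ 2^d: it says e · r ≤ ℓ d · x.
  negative-case : ∀ {n d} {ρ ρ' : Env n} {a b} → SameCut (ℓ d) (κ d) a b ρ ρ' →
    ∀ k (r : Term n) → suc k ℕ.≤ 2 ^ d → depth r ℕ.≤ d →
    ⟦ r ⟧ ρ ≤ suc k · a → ⟦ r ⟧ ρ' ≤ suc k · b
  negative-case {n} {d} {ρ} {ρ'} {a} {b} cut k r ν≤ dr r≤νa with cofactor d (suc k) (ℕ.s≤s ℕ.z≤n) ν≤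
  ... | e , ℓ≡ , e≤ =
    ·-cancel-≤ e (subst₂ _≤_ (·ᵀ-sem (suc e) r ρ') (ℓ·≡ b) (proj₁ (cut u du) u≤La))
    where
    u : Term n
    u = suc e ·ᵀ r
    du : depth u ℕ.≤ κ d
    du = ℕ.m≤n⇒m≤1+n (depth-scaled d (suc e) r e≤ dr)
    ℓ·≡ : ∀ x → ℓ d · x ≡ suc e · (suc k · x)
    ℓ·≡ x = trans (cong (_· x) ℓ≡) (sym (×-assocˡ x (suc e) (suc k)))
    u≤La : ⟦ u ⟧ ρ ≤ ℓ d · a
    u≤La = subst₂ _≤_ (sym (·ᵀ-sem (suc e) r ρ)) (sym (ℓ·≡ a)) (·-mono-≤ (suc e) r≤νa)

  transfer-isolated : ∀ {n d} {ρ ρ' : Env n} {a b} →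
    SignsTransfer d ρ ρ' → SameCut (ℓ d) (κ d) a b ρ ρ' →
    ∀ p q (r : Term n) → depth r ℕ.≤ d → p ℕ.+ q ℕ.≤ 2 ^ d → ∀ Va Vb →
    Va + q · a ≡ p · a + ⟦ r ⟧ ρ → Vb + q · b ≡ p · b + ⟦ r ⟧ ρ' → Va ≤ 0# → Vb ≤ 0#
  transfer-isolated {d = d} {ρ} {ρ'} {a} {b} tr cut p q r dr p+q≤ Va Vb ea eb Va≤0 with ℕ.compare p q
  ... | ℕ.equal p = subst (_≤ 0#) (sym (solve-equal p b Vb _ eb))
                      (tr r dr (subst (_≤ 0#) (solve-equal p a Va _ ea) Va≤0))
  ... | ℕ.greater q k = subst (_≤ 0#) (sym (solve-greater q k b Vb _ eb))
                          (positive-case cut k r μ≤ dr (subst (_≤ 0#) (solve-greater q k a Va _ ea) Va≤0))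
    where
    μ≤ : suc k ℕ.≤ 2 ^ d
    μ≤ = ℕ.≤-trans (ℕ.s≤s (ℕ.≤-trans (ℕ.m≤n+m k q) (ℕ.m≤m+n (q ℕ.+ k) q))) p+q≤
  ... | ℕ.less p k = +-cancelʳ-≤ (suc k · b) (subst₂ _≤_ (sym Vb+νb≡) (sym (identityˡ _)) r'≤νb)
    where
    ν≤ : suc k ℕ.≤ 2 ^ d
    ν≤ = ℕ.≤-trans (ℕ.≤-trans (ℕ.s≤s (ℕ.m≤n+m k p)) (ℕ.m≤n+m (suc (p ℕ.+ k)) p)) p+q≤
    Va+νa≡ : Va + suc k · a ≡ ⟦ r ⟧ ρ
    Va+νa≡ = solve-less p k a Va _ ea
    Vb+νb≡ : Vb + suc k · b ≡ ⟦ r ⟧ ρ'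
    Vb+νb≡ = solve-less p k b Vb _ eb
    r'≤νb : ⟦ r ⟧ ρ' ≤ suc k · b
    r'≤νb = negative-case cut k r ν≤ dr (subst₂ _≤_ Va+νa≡ (identityˡ _) (+-monoʳ-≤ (suc k · a) Va≤0))

  extend-transfer : ∀ {n} d {ρ ρ' : Env n} {a b} →
    SignsTransfer d ρ ρ' → SameCut (ℓ d) (κ d) a b ρ ρ' → SignsTransfer d (extend a ρ) (extend b ρ')
  extend-transfer d {ρ} {ρ'} {a} {b} tr cut t dt =
    transfer-isolated tr cut (plus (isolate t)) (minus (isolate t)) (rest (isolate t))
      (ℕ.≤-trans (depth-rest t) dt) (ℕ.≤-trans (coefficients-bound t) (ℕ.^-monoʳ-≤ 2 dt))
      _ _ (isolate-sem t a ρ) (isolate-sem t b ρ')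

greatest : ExcludedMiddle 0ℓ → (T : TotalOrder 0ℓ 0ℓ 0ℓ) → let open TotalOrder T in
  ∀ {A : Set} (P : A → Set) (f : A → Carrier) xs →
  (∀ u → u ∈ xs → ¬ P u) ⊎ (∃ λ u → P u × ∀ w → w ∈ xs → P w → f w ≤ f u)
greatest em T P f [] = inj₁ λ _ ()
greatest em T P f (x ∷ xs) with greatest em T P f xs | em {P x}
... | inj₁ none         | no ¬Px = inj₁ λ { u (here refl) → ¬Px ; u (there u∈) → none u u∈ }
... | inj₂ (u , Pu , max) | no ¬Px =
  inj₂ (u , Pu , λ { w (here refl) Pw → ⊥-elim (¬Px Pw) ; w (there w∈) → max w w∈ })
... | inj₁ none         | yes Px =
  inj₂ (x , Px , λ { w (here refl) _ → TotalOrder.refl T ; w (there w∈) Pw → ⊥-elim (none w w∈ Pw) })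
... | inj₂ (u , Pu , max) | yes Px with TotalOrder.total T (f x) (f u)
...   | inj₁ x≤u = inj₂ (u , Pu , λ { w (here refl) _ → x≤u ; w (there w∈) → max w w∈ })
...   | inj₂ u≤x = inj₂ (x , Px , λ { w (here refl) _ → TotalOrder.refl T
                                      ; w (there w∈) Pw → TotalOrder.trans T (max w w∈ Pw) u≤x })

-- The number of rounds k left in the back-and-forth game determines the depth
-- D k of the terms whose signs are compared, and the modulus M k of the
-- congruence that similar environments satisfy.
D M : ℕ → ℕ
D zero    = 0
D (suc k) = 4 ℕ.+ (κ (D k) ℕ.+ M (suc k))
M zero    = 1
M (suc k) = ℓ (D k) ℕ.* M k

M≢0 : ∀ {k} → ℕ.NonZero (M k)
M≢0 {zero}  = _
M≢0 {suc k} = ℕ.m*n≢0 (ℓ (D k)) (M k) {{ℕ._!≢0 (2 ^ D k)}} {{M≢0 {k}}}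

D-increasing : ∀ k → k ℕ.≤ D k
D-increasing zero    = ℕ.z≤n
D-increasing (suc k) = ℕ.s≤s (ℕ.≤-trans (D-increasing k) (ℕ.≤-trans (ℕ.m≤n+m (D k) (ℓ (D k)))
                         (ℕ.≤-trans (ℕ.n≤1+n _) (ℕ.≤-trans (ℕ.m≤m+n _ (M (suc k))) (ℕ.m≤n+m _ 3)))))

module BackAndForth (em : ExcludedMiddle 0ℓ) (G : ZGroup) where
  open DivisionWithRemainder em G
  open SignTransfer em G
  open TermSemantics G
  open Semantics G
  open ≡-Reasoning

  record Similar {n} (k : ℕ) (ρ ρ' : Env n) : Set where
    field
      congruent : ∀ i → ∃ λ y → ρ' i ≡ ρ i + M k · y
      forth     : SignsTransfer (D k) ρ ρ'
      back      : SignsTransfer (D k) ρ' ρ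
  open Similar

  similar-sym : ∀ {n k} {ρ ρ' : Env n} → Similar k ρ ρ' → Similar k ρ' ρ
  similar-sym {k = k} {ρ} {ρ'} sim = record
    { congruent = λ i → - proj₁ (congruent sim i) , ρ≡ i
    ; forth     = back sim
    ; back      = forth sim
    }
    where
    ρ≡ : ∀ i → ρ i ≡ ρ' i + M k · (- proj₁ (congruent sim i))
    ρ≡ i = sym (begin
      ρ' i + M k · (- y)      ≡⟨ cong₂ _+_ (proj₂ (congruent sim i)) (·-neg (M k) y) ⟩
      ρ i + M k · y - M k · y ≡⟨ //-rightDividesʳ (M k · y) (ρ i) ⟩
      ρ i                     ∎)
      where
      y : Carrier
      y = proj₁ (congruent sim i)

  congruent-values : ∀ {n} N {ρ ρ' : Env n} → (∀ i → ∃ λ y → ρ' i ≡ ρ i + N · y) →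
                     ∀ u → ∃ λ z → ⟦ u ⟧ ρ' ≡ ⟦ u ⟧ ρ + N · z
  congruent-values N cong-ρ (var i) = cong-ρ i
  congruent-values N cong-ρ zer     = 0# , sym (trans (cong (0# +_) (·-0 N)) (identityˡ 0#))
  congruent-values N cong-ρ one     = 0# , sym (trans (cong (1# +_) (·-0 N)) (identityʳ 1#))
  congruent-values N {ρ} {ρ'} cong-ρ (s ⊕ t)
    with congruent-values N cong-ρ s | congruent-values N cong-ρ t
  ... | z₁ , e₁ | z₂ , e₂ = z₁ + z₂ , (begin
    ⟦ s ⟧ ρ' + ⟦ t ⟧ ρ'                              ≡⟨ cong₂ _+_ e₁ e₂ ⟩
    (⟦ s ⟧ ρ + N · z₁) + (⟦ t ⟧ ρ + N · z₂)          ≡⟨ interchange _ _ _ _ ⟩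
    (⟦ s ⟧ ρ + ⟦ t ⟧ ρ) + (N · z₁ + N · z₂)          ≡⟨ cong (_ +_) (sym (×-distrib-+ z₁ z₂ N)) ⟩
    (⟦ s ⟧ ρ + ⟦ t ⟧ ρ) + N · (z₁ + z₂)              ∎)
  congruent-values N {ρ} {ρ'} cong-ρ (neg t) with congruent-values N cong-ρ t
  ... | z , e = - z , (begin
    - ⟦ t ⟧ ρ'                   ≡⟨ cong -_ e ⟩
    - (⟦ t ⟧ ρ + N · z)          ≡⟨ sym (⁻¹-∙-comm _ _) ⟩
    - ⟦ t ⟧ ρ + - (N · z)        ≡⟨ cong (- ⟦ t ⟧ ρ +_) (sym (·-neg N z)) ⟩
    - ⟦ t ⟧ ρ + N · (- z)        ∎)

  divMod′ : ∀ N .{{_ : ℕ.NonZero N}} g → ∃ λ h → ∃ λ r → r ℕ.< N × g ≡ N · h + r · 1#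
  divMod′ (suc Q) g = divMod Q g

  module Extension {n} (k : ℕ) (ρ ρ' : Env n) (sim : Similar (suc k) ρ ρ') (a : Carrier) where
    private
      d m L K Q K₂ : ℕ
      d  = D k
      m  = M k
      L  = ℓ d
      K  = κ d
      Q  = M (suc k)
      K₂ = 2 ℕ.+ (K ℕ.+ Q)

      La : Carrier
      La = L · a

    K≤K₂ : K ℕ.≤ K₂
    K≤K₂ = ℕ.≤-trans (ℕ.m≤m+n K Q) (ℕ.m≤n+m _ 2)

    compare-forth : ∀ u w → depth u ℕ.≤ K₂ → depth w ℕ.≤ K₂ →
                    ⟦ u ⟧ ρ ≤ ⟦ w ⟧ ρ → ⟦ u ⟧ ρ' ≤ ⟦ w ⟧ ρ'
    compare-forth u w du dw = ≤-transfer (forth sim) u w (depth-difference K₂ u w du dw)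

    compare-back : ∀ u w → depth u ℕ.≤ K₂ → depth w ℕ.≤ K₂ →
                   ⟦ u ⟧ ρ' ≤ ⟦ w ⟧ ρ' → ⟦ u ⟧ ρ ≤ ⟦ w ⟧ ρ
    compare-back u w du dw = ≤-transfer (back sim) u w (depth-difference K₂ u w du dw)

    weaken : ∀ {σ σ' : Env n} → SignsTransfer (D (suc k)) σ σ' → SignsTransfer d σ σ'
    weaken tr t dt = tr t (ℕ.≤-trans dt d≤)
      where
      d≤ : d ℕ.≤ D (suc k)
      d≤ = ℕ.≤-trans (ℕ.m≤n⇒m≤1+n (ℕ.m≤n+m d L)) (ℕ.≤-trans K≤K₂ (ℕ.m≤n+m K₂ 2))

    La-shift : ∀ z → L · (a + m · z) ≡ La + Q · z
    La-shift z = trans (×-distrib-+ a (m · z) L) (cong (La +_) (×-assocˡ z L m))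

    partner : ∀ b z → b ≡ a + m · z → SameCut L K a b ρ ρ' → SameCut L K b a ρ' ρ →
              Similar k (extend a ρ) (extend b ρ')
    partner b z b≡ cut cut' = record
      { congruent = λ { Fin.zero → z , b≡ ; (Fin.suc i) → old i }
      ; forth     = extend-transfer d (weaken (forth sim)) cut
      ; back      = extend-transfer d (weaken (back sim)) cut'
      }
      where
      old : ∀ i → ∃ λ y → ρ' i ≡ ρ i + m · y
      old i with congruent sim i
      ... | y , e = L · y , trans e (cong (ρ i +_) Qy≡)
        where
        Qy≡ : Q · y ≡ m · (L · y)
        Qy≡ = trans (cong (_· y) (ℕ.*-comm L m)) (sym (×-assocˡ y m L))

    cut-at-term : ∀ {σ σ' : Env n} {x y} u₀ → depth u₀ ℕ.≤ K₂ →
      L · x ≡ ⟦ u₀ ⟧ σ → L · y ≡ ⟦ u₀ ⟧ σ' →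
      (∀ u w → depth u ℕ.≤ K₂ → depth w ℕ.≤ K₂ → ⟦ u ⟧ σ ≤ ⟦ w ⟧ σ → ⟦ u ⟧ σ' ≤ ⟦ w ⟧ σ') →
      SameCut L K x y σ σ'
    cut-at-term {σ} {σ'} u₀ du₀ Lx≡ Ly≡ compare u du =
      (λ u≤Lx → subst (⟦ u ⟧ σ' ≤_) (sym Ly≡)
                  (compare u u₀ du' du₀ (subst (⟦ u ⟧ σ ≤_) Lx≡ u≤Lx))) ,
      (λ Lx≤u → subst (_≤ ⟦ u ⟧ σ') (sym Ly≡)
                  (compare u₀ u du₀ du' (subst (_≤ ⟦ u ⟧ σ) Lx≡ Lx≤u)))
      where
      du' : depth u ℕ.≤ K₂
      du' = ℕ.≤-trans du K≤K₂

    -- Case 1: L · a is the value of a small term u₀; take L · b to be its value under ρ'.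
    partner-at-term : ∀ u₀ → depth u₀ ℕ.≤ K₂ → La ≡ ⟦ u₀ ⟧ ρ →
                      ∃ λ b → Similar k (extend a ρ) (extend b ρ')
    partner-at-term u₀ du₀ La≡ with congruent-values Q (congruent sim) u₀
    ... | z , u₀'≡ = a + m · z , partner _ z refl (cut-at-term u₀ du₀ La≡ Lb≡ compare-forth)
                                                 (cut-at-term u₀ du₀ Lb≡ La≡ compare-back)
      where
      Lb≡ : L · (a + m · z) ≡ ⟦ u₀ ⟧ ρ'
      Lb≡ = trans (La-shift z) (trans (cong (_+ Q · z) La≡) (sym u₀'≡))

    module BetweenTerms (apart : ∀ u → depth u ℕ.≤ K₂ → La ≢ ⟦ u ⟧ ρ) where
      lower upper : Term n → Set
      lower u = depth u ℕ.≤ K × ⟦ u ⟧ ρ < La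
      upper u = depth u ℕ.≤ K × La < ⟦ u ⟧ ρ

      -- the strict cut conditions suffice, as no small term takes the value L · a
      partner-strict : ∀ b z → b ≡ a + m · z →
        (∀ u → lower u → ⟦ u ⟧ ρ' < L · b) → (∀ u → upper u → L · b < ⟦ u ⟧ ρ') →
        ∃ λ b → Similar k (extend a ρ) (extend b ρ')
      partner-strict b z b≡ below above = b , partner b z b≡ cut cut'
        where
        ≢La : ∀ u → depth u ℕ.≤ K → ⟦ u ⟧ ρ ≢ La
        ≢La u du = apart u (ℕ.≤-trans du K≤K₂) ∘ sym
        cut : SameCut L K a b ρ ρ'
        cut u du = (λ u≤La → proj₁ (below u (du , u≤La , ≢La u du)))
                 , (λ La≤u → proj₁ (above u (du , La≤u , ≢La u du ∘ sym)))
        cut' : SameCut L K b a ρ' ρ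
        cut' u du = (λ u'≤Lb → dne λ u≰La → <⇒≱ (above u (du , ≰⇒> u≰La)) u'≤Lb)
                  , (λ Lb≤u' → dne λ La≰u → <⇒≱ (below u (du , ≰⇒> La≰u)) Lb≤u')

      depth-shifted : ∀ (u : Term n) j → depth u ℕ.≤ K → j ℕ.≤ suc Q →
                      depth (u ⊕ numeralᵀ j) ℕ.≤ K₂
      depth-shifted u j du j≤ =
        ℕ.s≤s (ℕ.⊔-lub (ℕ.≤-trans du (ℕ.≤-trans (ℕ.m≤m+n K Q) (ℕ.n≤1+n _)))
                       (ℕ.≤-trans (depth-numeralᵀ j) (ℕ.≤-trans j≤ (ℕ.s≤s (ℕ.m≤n+m Q K)))))

      -- lo + (Q + 1) is still below L · a, as no small term lies in between; so it is
      -- below every upper term, and this comparison transfers to ρ'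
      shifted-below-upper : ∀ lo → lower lo → ∀ u → upper u → ⟦ lo ⟧ ρ' + suc Q · 1# < ⟦ u ⟧ ρ'
      shifted-below-upper lo (dlo , lo<La) u (du , La<u) =
        ≰⇒> λ u'≤ → <⇒≱ (<-trans lo+Q+1<La La<u)
          (subst (⟦ u ⟧ ρ ≤_) (shifted-sem ρ)
            (compare-back u w du' dw (subst (⟦ u ⟧ ρ' ≤_) (sym (shifted-sem ρ')) u'≤)))
        where
        w : Term n
        w = lo ⊕ numeralᵀ (suc Q)
        dw : depth w ℕ.≤ K₂
        dw = depth-shifted lo (suc Q) dlo ℕ.≤-refl
        du' : depth u ℕ.≤ K₂
        du' = ℕ.≤-trans du K≤K₂
        shifted-sem : ∀ σ → ⟦ w ⟧ σ ≡ ⟦ lo ⟧ σ + suc Q · 1#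
        shifted-sem σ = cong (⟦ lo ⟧ σ +_) (numeralᵀ-sem (suc Q) σ)
        lo+Q+1<La : ⟦ lo ⟧ ρ + suc Q · 1# < La
        lo+Q+1<La = gap (⟦ lo ⟧ ρ) La (suc Q) lo<La λ j j≤ e →
          apart (lo ⊕ numeralᵀ j) (depth-shifted lo j dlo j≤)
                (trans e (cong (⟦ lo ⟧ ρ +_) (sym (numeralᵀ-sem j ρ))))

      -- Case 2a: lo is the largest small term below L · a.  Put L · b just above lo.
      from-below : ∀ lo → lower lo → (∀ w → w ∈ terms K → lower w → ⟦ w ⟧ ρ ≤ ⟦ lo ⟧ ρ) →
                   ∃ λ b → Similar k (extend a ρ) (extend b ρ')
      from-below lo (dlo , lo<La) lo-max with divMod′ Q {{M≢0 {suc k}}} (⟦ lo ⟧ ρ' + 1# - La)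
      ... | h , r , r<Q , eh = partner-strict b (h + 1#) refl below above
        where
        b : Carrier
        b = a + m · (h + 1#)
        lo' X : Carrier
        lo' = ⟦ lo ⟧ ρ'
        X = lo' + 1# - r · 1#
        Lb≡ : L · b ≡ X + Q · 1#
        Lb≡ = begin
          L · b                  ≡⟨ La-shift (h + 1#) ⟩
          La + Q · (h + 1#)      ≡⟨ cong (La +_) (×-distrib-+ h 1# Q) ⟩
          La + (Q · h + Q · 1#)  ≡⟨ sym (assoc _ _ _) ⟩
          La + Q · h + Q · 1#    ≡⟨ cong (_+ Q · 1#) (sub-rearrange (lo' + 1#) La _ _ eh) ⟩
          X + Q · 1#             ∎
        lo'<Lb : lo' < L · b
        lo'<Lb = <-≤-trans (x<x+1 lo') (subst₂ _≤_ (//-rightDividesˡ (r · 1#) (lo' + 1#)) (sym Lb≡)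
                   (+-monoˡ-≤ X (proj₁ (numeral-mono-< r<Q))))
        Lb≤ : L · b ≤ lo' + suc Q · 1#
        Lb≤ = subst₂ _≤_ (sym Lb≡) (assoc lo' 1# (Q · 1#))
                (+-monoʳ-≤ (Q · 1#) (sub-numeral-≤ (lo' + 1#) r))
        below : ∀ u → lower u → ⟦ u ⟧ ρ' < L · b
        below u (du , u<La) = ≤-<-trans (compare-forth u lo (ℕ.≤-trans du K≤K₂) (ℕ.≤-trans dlo K≤K₂)
                                         (lo-max u (terms-complete K u du) (du , u<La))) lo'<Lb
        above : ∀ u → upper u → L · b < ⟦ u ⟧ ρ'
        above u upper-u = ≤-<-trans Lb≤ (shifted-below-upper lo (dlo , lo<La) u upper-u)

      -- Case 2b: no small term lies below L · a, and hi is the least one above it.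
      -- Put L · b just below hi.
      from-above : ∀ hi → upper hi → (∀ w → w ∈ terms K → upper w → ⟦ hi ⟧ ρ ≤ ⟦ w ⟧ ρ) →
                   (∀ u → u ∈ terms K → ¬ lower u) → ∃ λ b → Similar k (extend a ρ) (extend b ρ')
      from-above hi (dhi , La<hi) hi-min none-below with divMod′ Q {{M≢0 {suc k}}} (⟦ hi ⟧ ρ' - 1# - La)
      ... | h , r , _ , eh = partner-strict b h refl below above
        where
        b : Carrier
        b = a + m · h
        hi' : Carrier
        hi' = ⟦ hi ⟧ ρ'
        Lb≡ : L · b ≡ hi' - 1# - r · 1#
        Lb≡ = trans (La-shift h) (sub-rearrange (hi' - 1#) La _ _ eh)
        Lb<hi' : L · b < hi'
        Lb<hi' = ≤-<-trans (subst (_≤ hi' - 1#) (sym Lb≡) (sub-numeral-≤ (hi' - 1#) r))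
                   (subst (hi' - 1# <_) (//-rightDividesˡ 1# hi') (x<x+1 (hi' - 1#)))
        below : ∀ u → lower u → ⟦ u ⟧ ρ' < L · b
        below u (du , u<La) = ⊥-elim (none-below u (terms-complete K u du) (du , u<La))
        above : ∀ u → upper u → L · b < ⟦ u ⟧ ρ'
        above u (du , La<u) =
          <-≤-trans Lb<hi' (compare-forth hi u (ℕ.≤-trans dhi K≤K₂) (ℕ.≤-trans du K≤K₂)
                                             (hi-min u (terms-complete K u du) (du , La<u)))

      zer∈ : zer {n} ∈ terms K
      zer∈ = terms-complete K zer ℕ.z≤n

      partner-between : ∃ λ b → Similar k (extend a ρ) (extend b ρ')
      partner-between with greatest em totalOrder lower (λ u → ⟦ u ⟧ ρ) (terms K)
      ... | inj₂ (lo , lower-lo , lo-max) = from-below lo lower-lo lo-max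
      ... | inj₁ none-below with greatest em ≥-totalOrder upper (λ u → ⟦ u ⟧ ρ) (terms K)
      ...   | inj₂ (hi , upper-hi , hi-min) = from-above hi upper-hi hi-min none-below
      -- the term 0 is small, so it lies strictly below or strictly above L · a
      ...   | inj₁ none-above with total 0# La
      ...     | inj₁ 0≤La = ⊥-elim (none-below zer zer∈ (ℕ.z≤n , 0≤La , apart zer ℕ.z≤n ∘ sym))
      ...     | inj₂ La≤0 = ⊥-elim (none-above zer zer∈ (ℕ.z≤n , La≤0 , apart zer ℕ.z≤n))

    extension : ∃ λ b → Similar k (extend a ρ) (extend b ρ')
    extension with em {∃ λ u₀ → depth u₀ ℕ.≤ K₂ × La ≡ ⟦ u₀ ⟧ ρ}
    ... | yes (u₀ , du₀ , La≡) = partner-at-term u₀ du₀ La≡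
    ... | no  ¬at-term         = BetweenTerms.partner-between λ u du La≡ → ¬at-term (u , du , La≡)

  atom-depth : ∀ {n} k (s t : Term n) → 2 ℕ.+ (depth s ℕ.+ depth t) ℕ.≤ k → depth (s ⊕ neg t) ℕ.≤ D k
  atom-depth k s t r≤k =
    ℕ.≤-trans (depth-difference _ s t (ℕ.m≤m+n (depth s) (depth t)) (ℕ.m≤n+m (depth t) (depth s)))
              (ℕ.≤-trans r≤k (D-increasing k))

  private
    ⊔-left : ∀ {m n o} → m ⊔ n ℕ.≤ o → m ℕ.≤ o
    ⊔-left = ℕ.m⊔n≤o⇒m≤o _ _
    ⊔-right : ∀ {m n o} → m ⊔ n ℕ.≤ o → n ℕ.≤ o
    ⊔-right = ℕ.m⊔n≤o⇒n≤o _ _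

  similar-sat : ∀ {n} (φ : Formula true n) k {ρ ρ' : Env n} → rank φ ℕ.≤ k → Similar k ρ ρ' →
                Sat φ ρ → Sat φ ρ'
  similar-sat (s ≐ t) k r≤k sim s≡t =
    antisym (≤-transfer (forth sim) s t (atom-depth k s t r≤k) (≤-reflexive s≡t))
            (≤-transfer (forth sim) t s (atom-depth k t s r≤k′) (≤-reflexive (sym s≡t)))
    where
    r≤k′ : 2 ℕ.+ (depth t ℕ.+ depth s) ℕ.≤ k
    r≤k′ = subst (λ z → 2 ℕ.+ z ℕ.≤ k) (ℕ.+-comm (depth s) (depth t)) r≤k
  similar-sat (s ≼ t) k r≤k sim s≤t = ≤-transfer (forth sim) s t (atom-depth k s t r≤k) s≤t
  similar-sat ⊥ᶠ       k r≤k sim ()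
  similar-sat ⊤ᶠ       k r≤k sim _ = _
  similar-sat (¬ᶠ φ)   k r≤k sim ¬sat = ¬sat ∘ similar-sat φ k r≤k (similar-sym sim)
  similar-sat (φ ∧ᶠ ψ) k r≤k sim (sat-φ , sat-ψ) =
    similar-sat φ k (⊔-left r≤k) sim sat-φ , similar-sat ψ k (⊔-right r≤k) sim sat-ψ
  similar-sat (φ ∨ᶠ ψ) k r≤k sim (inj₁ sat-φ) = inj₁ (similar-sat φ k (⊔-left r≤k) sim sat-φ)
  similar-sat (φ ∨ᶠ ψ) k r≤k sim (inj₂ sat-ψ) = inj₂ (similar-sat ψ k (⊔-right r≤k) sim sat-ψ)
  similar-sat (φ ⇒ᶠ ψ) k r≤k sim φ⇒ψ =
    similar-sat ψ k (⊔-right r≤k) sim ∘ φ⇒ψ ∘ similar-sat φ k (⊔-left r≤k) (similar-sym sim)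
  -- ∀: a witness g' under ρ' has a partner g under ρ (play the game backwards)
  similar-sat (∀ᶠ φ) (suc k) {ρ} {ρ'} (ℕ.s≤s r≤k) sim sat g'
    with Extension.extension k ρ' ρ (similar-sym sim) g'
  ... | g , sim' = similar-sat φ k r≤k (similar-sym sim') (sat g)
  similar-sat (∃ᶠ φ) (suc k) {ρ} {ρ'} (ℕ.s≤s r≤k) sim (g , sat) with Extension.extension k ρ ρ' sim g
  ... | g' , sim' = g' , similar-sat φ k r≤k sim' sat

module DivisibleElements (em : ExcludedMiddle 0ℓ) (G : ZGroup) where
  open ResidueMaps em G
  open SignTransfer em G
  open BackAndForth em G
  open TermSemantics G
  open Semantics G
  open ≡-Reasoning

  σ₀ : Env 0
  σ₀ ()

  closed-value : ∀ (t : Term 0) → ∃ λ r → ∃ λ s → ⟦ t ⟧ σ₀ + s · 1# ≡ r · 1#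
  closed-value zer = 0 , 0 , identityˡ 0#
  closed-value one = 1 , 0 , refl
  closed-value (s ⊕ t) with closed-value s | closed-value t
  ... | r₁ , s₁ , e₁ | r₂ , s₂ , e₂ = r₁ ℕ.+ r₂ , s₁ ℕ.+ s₂ , (begin
    (⟦ s ⟧ σ₀ + ⟦ t ⟧ σ₀) + (s₁ ℕ.+ s₂) · 1#           ≡⟨ cong (_ +_) (×-homo-+ 1# s₁ s₂) ⟩
    (⟦ s ⟧ σ₀ + ⟦ t ⟧ σ₀) + (s₁ · 1# + s₂ · 1#)        ≡⟨ interchange _ _ _ _ ⟩
    (⟦ s ⟧ σ₀ + s₁ · 1#) + (⟦ t ⟧ σ₀ + s₂ · 1#)        ≡⟨ cong₂ _+_ e₁ e₂ ⟩
    r₁ · 1# + r₂ · 1#                                   ≡⟨ sym (×-homo-+ 1# r₁ r₂) ⟩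
    (r₁ ℕ.+ r₂) · 1#                                    ∎)
  closed-value (neg t) with closed-value t
  ... | r , s , e = s , r , trans (cong (- ⟦ t ⟧ σ₀ +_) (sym e)) (\\-leftDividesʳ (⟦ t ⟧ σ₀) (s · 1#))

  module _ (c : Carrier) (0<c : 0# < c) (c-div : ∀ n → ∃ λ y → c ≡ suc n · y) where

    numeral<c : ∀ j → j · 1# < c
    numeral<c j with c-div j
    ... | y , c≡ = <-≤-trans (numeral-mono-< (ℕ.n<1+n j))
                             (subst (suc j · 1# ≤_) (sym c≡) (·-mono-≤ (suc j) 1≤y))
      where
      1≤y : 1# ≤ y
      1≤y = 1-least y (≰⇒> λ y≤0 → <⇒≱ 0<c (subst (_≤ 0#) (sym c≡) (·-nonpos (suc j) y≤0)))

    ≤-multiple : ∀ μ {x} → c ≤ x → x ≤ suc μ · x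
    ≤-multiple μ {x} c≤x =
      subst (_≤ suc μ · x) (identityʳ x) (+-monoˡ-≤ x (·-nonneg μ (≤-trans (proj₁ 0<c) c≤x)))

    eventual-sign-linear : ∀ p q r s C (V : Carrier → Carrier) → C + s · 1# ≡ r · 1# →
      (∀ x → V x + q · x ≡ p · x + C) → ∀ {x y} → c ≤ x → c ≤ y → V x ≤ 0# → V y ≤ 0#
    eventual-sign-linear p q r s C V C≡ V≡ {x} {y} c≤x c≤y Vx≤0 with ℕ.compare p q
    ... | ℕ.equal p =
      subst (_≤ 0#) (trans (solve-equal p x (V x) C (V≡ x)) (sym (solve-equal p y (V y) C (V≡ y)))) Vx≤0
    ... | ℕ.greater q k = ⊥-elim (<⇒≱ 0<Vx (subst (_≤ 0#) (solve-greater q k x (V x) C (V≡ x)) Vx≤0))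
      where
      -C≤s : - C ≤ s · 1#
      -C≤s = subst (- C ≤_) (trans (cong (- C +_) (sym C≡)) (\\-leftDividesʳ C (s · 1#)))
               (subst (_≤ - C + r · 1#) (identityʳ (- C)) (+-monoˡ-≤ (- C) (numeral-nonneg r)))
      0<Vx : 0# < suc k · x + C
      0<Vx = subst (_< suc k · x + C) (inverseˡ C)
               (+-monoʳ-< C (≤-<-trans -C≤s (<-≤-trans (numeral<c s) (≤-trans c≤x (≤-multiple k c≤x)))))
    ... | ℕ.less p k =
      +-cancelʳ-≤ (suc k · y) (subst₂ _≤_ (sym (solve-less p k y (V y) C (V≡ y))) (sym (identityˡ _)) (proj₁ C<νy))
      where
      C≤r : C ≤ r · 1#
      C≤r = subst₂ _≤_ (identityʳ C) C≡ (+-monoˡ-≤ C (numeral-nonneg s))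
      C<νy : C < suc k · y
      C<νy = ≤-<-trans C≤r (<-≤-trans (numeral<c r) (≤-trans c≤y (≤-multiple k c≤y)))

    eventual-sign : ∀ (t : Term 1) {x y} → c ≤ x → c ≤ y → ⟦ t ⟧ [ x ] ≤ 0# → ⟦ t ⟧ [ y ] ≤ 0#
    eventual-sign t with closed-value (rest (isolate t))
    ... | r , s , C≡ = eventual-sign-linear (plus (isolate t)) (minus (isolate t)) r s _ (λ z → ⟦ t ⟧ [ z ]) C≡
                         λ z → trans (cong (_+ _) (⟦⟧-ext t λ { Fin.zero → refl })) (isolate-sem t z σ₀)

    c-similar-2c : ∀ k → Similar k [ c ] [ c + c ]
    c-similar-2c k = record
      { congruent = λ _ → y , cong (c +_) (trans c≡ (cong (_· y) (ℕ.suc-pred (M k) {{M≢0 {k}}})))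
      ; forth     = λ t _ → eventual-sign t ≤-refl c≤2c
      ; back      = λ t _ → eventual-sign t c≤2c ≤-refl
      }
      where
      y : Carrier
      y = proj₁ (c-div (ℕ.pred (M k)))
      c≡ : c ≡ suc (ℕ.pred (M k)) · y
      c≡ = proj₂ (c-div (ℕ.pred (M k)))
      c≤2c : c ≤ c + c
      c≤2c = subst (_≤ c + c) (identityʳ c) (+-monoˡ-≤ c (proj₁ 0<c))

  -- In a Leibnizian ordered Z-group no positive element is divisible by every N:
  -- a formula separating c from c + c would contradict their similarity.
  no-divisible-element : Leibnizian true G → ∀ c → 0# < c → (∀ n → ∃ λ y → c ≡ suc n · y) → ⊥
  no-divisible-element leib c 0<c c-div with leib c (c + c) (pos⇒x≢x+x 0<c)
  ... | φ , sat-c , ¬sat-2c =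
    ¬sat-2c (similar-sat φ (rank φ) ℕ.≤-refl (c-similar-2c c 0<c c-div (rank φ)) sat-c)

  -- If res a ≈ res b with a ≠ b, then |a - b| is such an element.
  ordered⇒resInjective : Leibnizian true G → ResInjective G
  ordered⇒resInjective leib r isRes a b ra≈rb = dne λ a≢b → case total b a of λ where
      (inj₁ b≤a) → separated a b b≤a a≢b same
      (inj₂ a≤b) → separated b a a≤b (a≢b ∘ sym) (sym ∘ same)
    where
    same : ∀ n → rem a n ≡ rem b n
    same n = trans (sym (residue-map-unique {r} isRes a n)) (trans (ra≈rb n) (residue-map-unique {r} isRes b n))
    separated : ∀ x y → y ≤ x → x ≢ y → (∀ n → rem x n ≡ rem y n) → ⊥
    separated x y y≤x x≢y same-xy = no-divisible-element leib (x - y)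
      (subst (_≤ x - y) (inverseʳ y) (+-monoʳ-≤ (- y) y≤x) , x≢y ∘ x∙y⁻¹≈ε⇒x≈y x y ∘ sym)
      (same-rem⇒divisible x y same-xy)

theorem3p3 : ExcludedMiddle 0ℓ → (G : ZGroup) →
    (Leibnizian true G ⇔ Leibnizian false G) × (Leibnizian true G ⇔ ResInjective G)
theorem3p3 em G =
  mk⇔ (resInjective⇒unordered ∘ ordered⇒resInjective) unordered⇒ordered ,
  mk⇔ ordered⇒resInjective (unordered⇒ordered ∘ resInjective⇒unordered)
  where
  open Separation em G
  open DivisibleElements em G
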